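{- Let $\epsilon>0$. There exists $n_2(\epsilon)$ such that if $n>n_2(\epsilon)$ the following holds. Let $m=\binom{n}{2}$, $M=\lceil m/2\rceil$, let $k$ be an integer with $M+1\le k<M+n$, let $X\subseteq\mathcal{G}^{(k)}$, and let $x$ be a real number with $|X|=\binom{x}{k}$ and $x>\binom{n-1}{2}+\epsilon n$. Then $|\triangle(X)|>|X|$.
   Context: Graphs are simple. $\mathcal{G}^{(j)}$ is the set of connected graphs on vertex set $[n]$ with exactly $j$ edges. For $X\subseteq\mathcal{G}^{(k)}$, the shadow is $\triangle(X)=\{G\in\mathcal{G}^{(k-1)}:\exists H\in X,\ E(G)\subset E(H)\}$. For a positive integer $k$ and real $x$, $\binom{x}{k}=\frac{x(x-1)\cdots(x-k+1)}{k!}$ if $x\ge k$ and $0$ if $x<k$.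
   Formalization: The parameter ε ranges over the positive rationals. -}

module Defs where

open import Data.Nat as ℕ using (ℕ; zero; suc; _+_; _∸_; _!)
open import Data.Nat.Properties using (_!≢0)
open import Data.Bool using (Bool; true; false; if_then_else_; _∧_)
open import Data.Fin as Fin using (Fin; toℕ)
open import Data.Fin.Properties as FinP using ()
open import Data.Vec using (Vec; lookup)
open import Data.List using (List; map; allFin)
open import Data.Nat.ListAction using (sum)
open import Data.List.Membership.Propositional using (_∈_)
open import Data.List.Relation.Unary.Unique.Propositional using (Unique)
open import Data.Product using (Σ; _×_; ∃-syntax)
open import Data.Integer using (+_)
open import Data.Rational as ℚ using (ℚ; 0ℚ; _/_)
open import Data.Rational.Properties as ℚP using ()
open import Relation.Nullary using (does)
open import Relation.Binary.PropositionalEquality using (_≡_)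
open import Function.Bundles using (_⇔_)

ℕ→ℚ : ℕ → ℚ
ℕ→ℚ n = (+ n) / 1

falling : ℚ → ℕ → ℚ
falling x zero    = ℚ.1ℚ
falling x (suc k) = falling x k ℚ.* (x ℚ.- ℕ→ℚ k)

binomℚ : ℚ → ℕ → ℚ
binomℚ x k =
  if does (ℚ._≤?_ (ℕ→ℚ k) x)
  then falling x k ℚ.* (_/_ (+ 1) (k !) {{k !≢0}})
  else 0ℚ

Adj : ℕ → Set
Adj n = Vec (Vec Bool n) n

entry : ∀ {n} → Adj n → Fin n → Fin n → Bool
entry A i j = lookup (lookup A i) j

IsSimple : ∀ {n} → Adj n → Set
IsSimple {n} A = ((i j : Fin n) → entry A i j ≡ entry A j i) × ((i : Fin n) → entry A i i ≡ false)

edgeCount : ∀ {n} → Adj n → ℕ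
edgeCount {n} A =
  sum (map (λ i → sum (map (λ j → if does (i Fin.<? j) ∧ entry A i j then 1 else 0) (allFin n))) (allFin n))

data Walk {n} (A : Adj n) : Fin n → Fin n → Set where
  here : ∀ {u} → Walk A u u
  step : ∀ {u w v} → entry A u w ≡ true → Walk A w v → Walk A u v

Connected : ∀ {n} → Adj n → Set
Connected {n} A = (u v : Fin n) → Walk A u v

InG : (n j : ℕ) → Adj n → Set
InG n j A = IsSimple A × Connected A × edgeCount A ≡ j

EdgeSub : ∀ {n} → Adj n → Adj n → Set
EdgeSub {n} G H = (i j : Fin n) → entry G i j ≡ true → entry H i j ≡ true

Shadow : (n k : ℕ) → List (Adj n) → Adj n → Set
Shadow n k Xs G = InG n (k ∸ 1) G × ∃[ H ] (H ∈ Xs × EdgeSub G H)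

Enumerates : ∀ {n} → List (Adj n) → (Adj n → Set) → Set
Enumerates {n} S P = Unique S × ((G : Adj n) → (G ∈ S) ⇔ P G)

-- Double count the pairs (H , e) of a graph H ∈ X and one of its k edges e: there are |X| k of them, and
-- (H , e) is determined by (H − e , e).  If H − e is connected it lies in the shadow ∂X, and each graph
-- of ∂X arises from at most C(n,2) − (k − 1) ≤ k − 1 pairs, one per non-edge, because k > C(n,2)/2.
-- If H − e is disconnected, no edge of H − e crosses some cut (R , ∁R).  Either one side is a single
-- vertex, leaving n cuts and C(N , k − 1) choices of H − e, where N = C(n − 1, 2); or both sides have two
-- vertices, leaving at most 2ⁿ cuts and C(N − (n − 3), k − 1) choices.  Since k − 1 ≥ C(n,2)/2, lowering
-- the upper index of these binomial coefficients by one at least halves them, so there are at most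
-- C(n,2) (n + 8) C(N , k − 1) < 2^(t−1) C(N + 1, k) ≤ C(N + t, k) < |X| disconnected pairs, for a
-- t ≤ εn large enough that 2^(t−1) beats the cubic factor.  Hence |X| k < |∂X| (k − 1) + |X|.

module Submission where

open import Defs
open import Data.Nat using (ℕ; zero; suc; pred; _+_; _*_; _∸_; _^_; _≤_; _<_; _≤?_; z≤n; s≤s; _/_; _%_; _!; ⌈_/2⌉;
  NonZero; >-nonZero; >-nonZero⁻¹)
open import Data.Nat.Properties
open import Data.Nat.DivMod using (m/n*n≤m; m*n/n≡m; /-monoˡ-≤; m≡m%n+[m/n]*n; m%n<n)
open import Data.Nat.Combinatorics using (_C_; nCk+nC[k+1]≡[n+1]C[k+1]; nCk≡nC[n∸k]; nCn≡1; nC1≡n; k>n⇒nCk≡0)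
open import Data.Nat.Coprimality using (Coprime; 1-coprimeTo)
import Data.Nat.Coprimality as Coprime
open import Data.Nat.ListAction using (sum)
open import Data.Nat.Solver using (module +-*-Solver)
open +-*-Solver using (solve; _:+_; _:*_; _:^_; _:=_; con)
open import Data.Integer as ℤ using (+[1+_]; -[1+_]; +≤+)
import Data.Integer.Properties as ℤ
open import Data.Rational as ℚ using (ℚ; mkℚ; 0ℚ; 1ℚ; toℚᵘ; NonNegative; Positive)
import Data.Rational.Properties as ℚ
open import Data.Rational.Unnormalised as ℚᵘ using (mkℚᵘ; *≡*; *≤*; *<*)
import Data.Rational.Unnormalised.Properties as ℚᵘ
open import Data.Bool using (Bool; true; false; if_then_else_; not; _∧_)
import Data.Bool as Bool
open import Data.Fin as Fin using (Fin; zero; suc)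
open import Data.Fin.Properties using (any?)
open import Data.Fin.Subset using (Subset; inside; outside; ⊥; ⁅_⁆; ∣_∣; ∁; _∪_; _-_; _⊆_; Nonempty)
  renaming (_∈_ to _∈ₛ_; _∉_ to _∉ₛ_)
open import Data.Fin.Subset.Properties using (_∈?_; nonempty?; drop-∷-⊆; p─⊥≡p; p─q⊆p; ∣p∣≤n; ∣⁅x⁆∣≡1; ∣∁p∣≡n∸∣p∣;
  p⊂q⇒∣p∣<∣q∣; p⊆p∪q; x∈p∪q⁺; x∈p∪q⁻; x∈⁅x⁆; x∈⁅y⁆⇒x≡y; x∉∁p⇒x∈p; x∉p⇒x∈∁p)
open import Data.Vec as Vec using (Vec; []; _∷_; lookup; tail; take; drop; zipWith; tabulate; here; there)
open import Data.Vec.Properties using (∷-injectiveˡ; ∷-injectiveʳ; lookup-map; lookup-zipWith; lookup∘tabulate; tabulate-∘;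
  take++drop≡id; []=⇒lookup; lookup⇒[]=)
open import Data.List using (List; []; _∷_; [_]; _++_; length; map; concatMap; filter; allFin)
open import Data.List.Properties using (length-++; length-++-sucʳ; length-map; length-tabulate; length-filter; map-tabulate; map-cong)
open import Data.List.Relation.Unary.All as All using (All; []; _∷_)
import Data.List.Relation.Unary.All.Properties as All
open import Data.List.Relation.Unary.Any as Any using (here; there)
open import Data.List.Relation.Unary.AllPairs as AllPairs using ([]; _∷_)
import Data.List.Relation.Unary.AllPairs.Properties as AllPairs
open import Data.List.Relation.Unary.Unique.Propositional using (Unique)
import Data.List.Relation.Unary.Unique.Propositional.Properties as Unique
open import Data.List.Relation.Binary.Disjoint.Propositional using (Disjoint)
open import Data.List.Membership.Propositional using (_∈_; find)
open import Data.List.Membership.Propositional.Properties using (∈-∃++; ∈-map⁺; ∈-map⁻; ∈-concatMap⁺; ∈-concatMap⁻;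
  ∈-++⁺ˡ; ∈-++⁺ʳ; ∈-filter⁺; ∈-filter⁻; ∈-allFin)
open import Data.Product using (_×_; ∃-syntax; _,_; proj₁; proj₂)
open import Data.Product.Properties using (,-injectiveˡ; ,-injectiveʳ)
open import Data.Sum using (_⊎_; inj₁; inj₂)
open import Data.Empty using (⊥-elim)
open import Function using (_∘_; const)
open import Function.Bundles using (Equivalence)
open import Relation.Nullary using (¬_; Dec; yes; no; does; ¬?)
open import Relation.Nullary.Decidable using (_×-dec_; dec-true)
open import Relation.Binary.PropositionalEquality using (_≡_; _≢_; refl; sym; trans; cong; cong₂; subst; subst₂; module ≡-Reasoning)

Unique⇒length≤ : ∀ {A : Set} {xs ys : List A} → Unique xs → All (_∈ ys) xs → length xs ≤ length ys
Unique⇒length≤ {xs = []} _ _ = z≤n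
Unique⇒length≤ {xs = x ∷ xs} (x∉xs ∷ xs!) (x∈ys ∷ xs⊆ys)
  with ys₁ , ys₂ , refl ← ∈-∃++ x∈ys = begin
    suc (length xs)            ≤⟨ s≤s (Unique⇒length≤ xs! (All.zipWith (λ (x≢y , y∈) → ∈-++-skip ys₁ x≢y y∈) (x∉xs , xs⊆ys))) ⟩
    suc (length (ys₁ ++ ys₂))  ≡⟨ sym (length-++-sucʳ ys₁ x ys₂) ⟩
    length (ys₁ ++ x ∷ ys₂)    ∎
  where
  open ≤-Reasoning
  ∈-++-skip : ∀ {A : Set} {x y : A} ys₁ {ys₂} → x ≢ y → y ∈ ys₁ ++ x ∷ ys₂ → y ∈ ys₁ ++ ys₂
  ∈-++-skip []        x≢y (here refl)  = ⊥-elim (x≢y refl)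
  ∈-++-skip []        x≢y (there y∈ys) = y∈ys
  ∈-++-skip (_ ∷ ys₁) x≢y (here refl)  = here refl
  ∈-++-skip (_ ∷ ys₁) x≢y (there y∈ys) = there (∈-++-skip ys₁ x≢y y∈ys)

length-concatMap-≤ : ∀ {A B : Set} (f : A → List B) {b} (xs : List A) →
  All (λ x → length (f x) ≤ b) xs → length (concatMap f xs) ≤ length xs * b
length-concatMap-≤ f []       []             = z≤n
length-concatMap-≤ f (x ∷ xs) (fx≤b ∷ fxs≤b) = begin
  length (f x ++ concatMap f xs)          ≡⟨ length-++ (f x) ⟩
  length (f x) + length (concatMap f xs)  ≤⟨ +-mono-≤ fx≤b (length-concatMap-≤ f xs fxs≤b) ⟩
  _ + length xs * _                       ∎
  where open ≤-Reasoning

∈-concatMap : ∀ {A B : Set} (f : A → List B) {x y xs} → x ∈ xs → y ∈ f x → y ∈ concatMap f xs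
∈-concatMap f x∈xs y∈fx = ∈-concatMap⁺ f (Any.map (λ { refl → y∈fx }) x∈xs)

_⋉_ : ∀ {A B : Set} → List A → (A → List B) → List (A × B)
xs ⋉ f = concatMap (λ x → map (x ,_) (f x)) xs

∈-⋉ : ∀ {A B : Set} {xs : List A} {f : A → List B} {x y} → x ∈ xs → y ∈ f x → (x , y) ∈ xs ⋉ f
∈-⋉ {f = f} x∈xs y∈fx = ∈-concatMap (λ x → map (x ,_) (f x)) x∈xs (∈-map⁺ _ y∈fx)

∈-⋉⁻ : ∀ {A B : Set} {xs : List A} {f : A → List B} {x y} → (x , y) ∈ xs ⋉ f → x ∈ xs × y ∈ f x
∈-⋉⁻ {xs = xs} {f} xy∈ with x′ , x′∈xs , xy∈′ ← find (∈-concatMap⁻ (λ x → map (x ,_) (f x)) {xs = xs} xy∈)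
                       with _ , y∈ , refl ← ∈-map⁻ _ xy∈′ = x′∈xs , y∈

length-⋉ : ∀ {A B : Set} (xs : List A) (f : A → List B) {b} →
  All (λ x → length (f x) ≡ b) xs → length (xs ⋉ f) ≡ length xs * b
length-⋉ []       f []             = refl
length-⋉ (x ∷ xs) f (fx≡b ∷ fxs≡b) = begin
  length (map (x ,_) (f x) ++ xs ⋉ f)         ≡⟨ length-++ (map (x ,_) (f x)) ⟩
  length (map (x ,_) (f x)) + length (xs ⋉ f)  ≡⟨ cong₂ _+_ (trans (length-map _ (f x)) fx≡b) (length-⋉ xs f fxs≡b) ⟩
  _ + length xs * _                            ∎
  where open ≡-Reasoning

⋉⁺ : ∀ {A B : Set} {xs : List A} {f : A → List B} → Unique xs → (∀ x → Unique (f x)) → Unique (xs ⋉ f)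
⋉⁺ {f = f} xs! f! =
  Unique.concat⁺ (All.map⁺ (All.universal (λ x → Unique.map⁺ ,-injectiveʳ (f! x)) _))
                 (AllPairs.map⁺ (AllPairs.map disjoint xs!))
  where
  disjoint : ∀ {x x′} → x ≢ x′ → Disjoint (map (x ,_) (f x)) (map (x′ ,_) (f x′))
  disjoint x≢x′ (v∈ , v∈′) with _ , _ , refl ← ∈-map⁻ _ v∈ | _ , _ , eq ← ∈-map⁻ _ v∈′ =
    x≢x′ (,-injectiveˡ eq)

Unique-map⁺ : ∀ {A B : Set} {f : A → B} {xs : List A} →
  (∀ {x y} → x ∈ xs → y ∈ xs → f x ≡ f y → x ≡ y) → Unique xs → Unique (map f xs)
Unique-map⁺ {xs = []}     _   []            = []
Unique-map⁺ {xs = x ∷ xs} inj (x∉xs ∷ xs!) =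
  All.map⁺ (All.tabulate (λ {y} y∈xs fx≡fy → All.lookup x∉xs y∈xs (inj (here refl) (there y∈xs) fx≡fy)))
  ∷ Unique-map⁺ (λ x∈ y∈ → inj (there x∈) (there y∈)) xs!

-- Binomial coefficients

nC0≡1 : ∀ n → n C 0 ≡ 1
nC0≡1 n = trans (nCk≡nC[n∸k] (z≤n {n})) (nCn≡1 n)

pascal : ∀ n k → suc n C suc k ≡ n C k + n C suc k
pascal n k = sym (nCk+nC[k+1]≡[n+1]C[k+1] n k)

nCk≤[1+n]Ck : ∀ n k → n C k ≤ suc n C k
nCk≤[1+n]Ck n zero    = ≤-reflexive (trans (nC0≡1 n) (sym (nC0≡1 (suc n))))
nCk≤[1+n]Ck n (suc k) = ≤-trans (m≤n+m _ _) (≤-reflexive (sym (pascal n k)))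

C-monoˡ-≤ : ∀ {m n} k → m ≤ n → m C k ≤ n C k
C-monoˡ-≤ k m≤n with _ , refl ← m≤n⇒∃[o]m+o≡n m≤n = go _ _
  where
  go : ∀ m o → m C k ≤ (m + o) C k
  go m zero    = ≤-reflexive (cong (_C k) (sym (+-identityʳ m)))
  go m (suc o) = ≤-trans (go m o) (≤-trans (nCk≤[1+n]Ck (m + o) k) (≤-reflexive (cong (_C k) (sym (+-suc m o)))))

0<nCk : ∀ {n k} → k ≤ n → 0 < n C k
0<nCk {n} {zero}  _       = ≤-reflexive (sym (nC0≡1 n))
0<nCk {suc n} {suc k} (s≤s k≤n) = ≤-trans (0<nCk k≤n) (≤-trans (m≤m+n _ _) (≤-reflexive (sym (pascal n k))))

absorption : ∀ n k → suc k * (suc n C suc k) ≡ suc n * (n C k)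
absorption zero    zero    = refl
absorption zero    (suc k) = begin
  suc (suc k) * (1 C suc (suc k)) ≡⟨ cong (suc (suc k) *_) (k>n⇒nCk≡0 {1} {suc (suc k)} (s≤s (s≤s z≤n))) ⟩
  suc (suc k) * 0                 ≡⟨ *-zeroʳ (suc (suc k)) ⟩
  0                               ≡⟨ cong (1 *_) (k>n⇒nCk≡0 {0} {suc k} (s≤s z≤n)) ⟨
  1 * (0 C suc k)                 ∎
  where open ≡-Reasoning
absorption (suc n) zero    = trans (+-identityʳ _) (trans (nC1≡n (suc (suc n))) (sym (trans (cong (suc (suc n) *_) (nC0≡1 (suc n))) (*-identityʳ _))))
absorption (suc n) (suc k) = begin
  suc (suc k) * (suc (suc n) C suc (suc k))
    ≡⟨ cong (suc (suc k) *_) (trans (pascal (suc n) (suc k)) (cong₂ _+_ (pascal n k) (pascal n (suc k)))) ⟩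
  suc (suc k) * ((a + b) + (b + c))
    ≡⟨ solve 4 (λ K A B C → (con 2 :+ K) :* ((A :+ B) :+ (B :+ C)) :=
                 (con 1 :+ K) :* (A :+ B) :+ (A :+ B) :+ (con 2 :+ K) :* (B :+ C)) refl k a b c ⟩
  suc k * (a + b) + (a + b) + suc (suc k) * (b + c)
    ≡⟨ cong₂ (λ x y → x + (a + b) + y) (trans (cong (suc k *_) (sym (pascal n k))) (absorption n k))
                                        (trans (cong (suc (suc k) *_) (sym (pascal n (suc k)))) (absorption n (suc k))) ⟩
  suc n * a + (a + b) + suc n * b
    ≡⟨ solve 3 (λ N A B → (con 1 :+ N) :* A :+ (A :+ B) :+ (con 1 :+ N) :* B := (con 2 :+ N) :* (A :+ B)) refl n a b ⟩
  suc (suc n) * (a + b)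
    ≡⟨ cong (suc (suc n) *_) (sym (pascal n k)) ⟩
  suc (suc n) * (suc n C suc k) ∎
  where
  open ≡-Reasoning
  a = n C k
  b = n C suc k
  c = n C suc (suc k)

[k+1]*nC[k+1]+k*nCk≡n*nCk : ∀ n k → suc k * (n C suc k) + k * (n C k) ≡ n * (n C k)
[k+1]*nC[k+1]+k*nCk≡n*nCk zero    zero    = refl
[k+1]*nC[k+1]+k*nCk≡n*nCk zero    (suc k) = cong₂ _+_
  (trans (cong (suc (suc k) *_) (k>n⇒nCk≡0 {0} {suc (suc k)} (s≤s z≤n))) (*-zeroʳ (suc (suc k))))
  (trans (cong (suc k *_) (k>n⇒nCk≡0 {0} {suc k} (s≤s z≤n))) (*-zeroʳ (suc k)))
[k+1]*nC[k+1]+k*nCk≡n*nCk (suc n) zero    = begin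
  1 * (suc n C 1) + 0  ≡⟨ trans (+-identityʳ _) (*-identityˡ _) ⟩
  suc n C 1            ≡⟨ nC1≡n (suc n) ⟩
  suc n                ≡⟨ *-identityʳ (suc n) ⟨
  suc n * 1            ≡⟨ cong (suc n *_) (nC0≡1 (suc n)) ⟨
  suc n * (suc n C 0)  ∎
  where open ≡-Reasoning
[k+1]*nC[k+1]+k*nCk≡n*nCk (suc n) (suc k) = begin
  suc (suc k) * (suc n C suc (suc k)) + suc k * (suc n C suc k)
    ≡⟨ cong₂ _+_ (absorption n (suc k)) (absorption n k) ⟩
  suc n * (n C suc k) + suc n * (n C k)
    ≡⟨ trans (+-comm (suc n * (n C suc k)) _) (sym (*-distribˡ-+ (suc n) (n C k) (n C suc k))) ⟩
  suc n * (n C k + n C suc k)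
    ≡⟨ cong (suc n *_) (pascal n k) ⟨
  suc n * (suc n C suc k) ∎
  where open ≡-Reasoning

[k+1]*nC[k+1]≡[n∸k]*nCk : ∀ n k → suc k * (n C suc k) ≡ (n ∸ k) * (n C k)
[k+1]*nC[k+1]≡[n∸k]*nCk n k = begin
  suc k * (n C suc k)                             ≡⟨ m+n∸n≡m _ (k * (n C k)) ⟨
  suc k * (n C suc k) + k * (n C k) ∸ k * (n C k) ≡⟨ cong (_∸ k * (n C k)) ([k+1]*nC[k+1]+k*nCk≡n*nCk n k) ⟩
  n * (n C k) ∸ k * (n C k)                       ≡⟨ *-distribʳ-∸ (n C k) n k ⟨
  (n ∸ k) * (n C k)                               ∎
  where open ≡-Reasoning

nC[k+1]≤nCk : ∀ {n k} → n ≤ suc (2 * k) → n C suc k ≤ n C k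
nC[k+1]≤nCk {n} {k} n≤1+2k = *-cancelˡ-≤ (suc k) (begin
  suc k * (n C suc k)    ≡⟨ [k+1]*nC[k+1]≡[n∸k]*nCk n k ⟩
  (n ∸ k) * (n C k)      ≤⟨ *-monoˡ-≤ (n C k) n∸k≤1+k ⟩
  suc k * (n C k)        ∎)
  where
  open ≤-Reasoning
  n∸k≤1+k : n ∸ k ≤ suc k
  n∸k≤1+k = ≤-trans (∸-monoˡ-≤ k n≤1+2k) (≤-reflexive (trans
    (cong (_∸ k) (solve 1 (λ K → con 1 :+ con 2 :* K := K :+ (con 1 :+ K)) refl k)) (m+n∸m≡n k (suc k))))

2*nC[k+1]≤[n+1]C[k+1] : ∀ {n k} → n ≤ suc (2 * k) → 2 * (n C suc k) ≤ suc n C suc k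
2*nC[k+1]≤[n+1]C[k+1] {n} {k} n≤1+2k = begin
  2 * (n C suc k)              ≡⟨ cong (n C suc k +_) (+-identityʳ _) ⟩
  n C suc k + n C suc k        ≤⟨ +-monoˡ-≤ (n C suc k) (nC[k+1]≤nCk n≤1+2k) ⟩
  n C k + n C suc k            ≡⟨ pascal n k ⟨
  suc n C suc k                ∎
  where open ≤-Reasoning

2^t*nC[k+1]≤[n+t]C[k+1] : ∀ n k t → n + t ≤ 2 * suc k → 2 ^ t * (n C suc k) ≤ (n + t) C suc k
2^t*nC[k+1]≤[n+t]C[k+1] n k zero    _         = ≤-reflexive (trans (+-identityʳ _) (cong (_C suc k) (sym (+-identityʳ n))))
2^t*nC[k+1]≤[n+t]C[k+1] n k (suc t) n+t≤2+2k = begin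
  2 * 2 ^ t * (n C suc k)      ≡⟨ *-assoc 2 (2 ^ t) _ ⟩
  2 * (2 ^ t * (n C suc k))    ≤⟨ *-monoʳ-≤ 2 (2^t*nC[k+1]≤[n+t]C[k+1] n k t (≤-trans (+-monoʳ-≤ n (n≤1+n t)) n+t≤2+2k)) ⟩
  2 * ((n + t) C suc k)        ≤⟨ 2*nC[k+1]≤[n+1]C[k+1] n+t≤1+2k ⟩
  suc (n + t) C suc k          ≡⟨ cong (_C suc k) (+-suc n t) ⟨
  (n + suc t) C suc k          ∎
  where
  open ≤-Reasoning
  n+t≤1+2k : n + t ≤ suc (2 * k)
  n+t≤1+2k = ≤-pred (≤-trans (≤-reflexive (sym (+-suc n t))) (≤-trans n+t≤2+2k (≤-reflexive (*-suc 2 k))))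

2*nC2+n≡n*n : ∀ n → 2 * (n C 2) + n ≡ n * n
2*nC2+n≡n*n zero    = refl
2*nC2+n≡n*n (suc n) = begin
  2 * (suc n C 2) + suc n        ≡⟨ cong (λ x → 2 * x + suc n) (trans (pascal n 1) (cong (_+ n C 2) (nC1≡n n))) ⟩
  2 * (n + n C 2) + suc n        ≡⟨ solve 2 (λ N B → con 2 :* (N :+ B) :+ (con 1 :+ N) := (con 2 :* B :+ N) :+ (con 1 :+ con 2 :* N)) refl n (n C 2) ⟩
  (2 * (n C 2) + n) + (1 + 2 * n) ≡⟨ cong (_+ (1 + 2 * n)) (2*nC2+n≡n*n n) ⟩
  n * n + (1 + 2 * n)            ≡⟨ solve 1 (λ N → N :* N :+ (con 1 :+ con 2 :* N) := (con 1 :+ N) :* (con 1 :+ N)) refl n ⟩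
  suc n * suc n                  ∎
  where open ≡-Reasoning

[1+n]C2≡n+nC2 : ∀ n → suc n C 2 ≡ n + n C 2
[1+n]C2≡n+nC2 n = trans (pascal n 1) (cong (_+ n C 2) (nC1≡n n))

-- Subsets of Fin n

elements : ∀ {n} → Subset n → List (Fin n)
elements p = filter (_∈? p) (allFin _)

Unique-elements : ∀ {n} {p : Subset n} → Unique (elements p)
Unique-elements = Unique.filter⁺ _ (Unique.allFin⁺ _)

∈-elements⁺ : ∀ {n x} {p : Subset n} → x ∈ₛ p → x ∈ elements p
∈-elements⁺ x∈p = ∈-filter⁺ _ (∈-allFin _) x∈p

∈-elements⁻ : ∀ {n x} {p : Subset n} → x ∈ elements p → x ∈ₛ p
∈-elements⁻ {p = p} x∈ = proj₂ (∈-filter⁻ (_∈? p) {xs = allFin _} x∈)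

length-elements : ∀ {n} (p : Subset n) → length (elements p) ≡ ∣ p ∣
length-elements []      = refl
length-elements (s ∷ p) = trans (cong (λ xs → length (filter (_∈? s ∷ p) (zero ∷ xs))) (sym (map-tabulate (λ i → i) suc))) (count-first s)
  where
  count-shifted : ∀ {s} xs → length (filter (_∈? s ∷ p) (map suc xs)) ≡ length (filter (_∈? p) xs)
  count-shifted []       = refl
  count-shifted (x ∷ xs) with does (x ∈? p)
  ... | true  = cong suc (count-shifted xs)
  ... | false = count-shifted xs
  count-first : ∀ s → length (filter (_∈? s ∷ p) (zero ∷ map suc (allFin _))) ≡ ∣ s ∷ p ∣
  count-first inside  = cong suc (trans (count-shifted (allFin _)) (length-elements p))
  count-first outside = trans (count-shifted (allFin _)) (length-elements p)

x∈p⇒suc∣p-x∣≡∣p∣ : ∀ {n x} {p : Subset n} → x ∈ₛ p → suc ∣ p - x ∣ ≡ ∣ p ∣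
x∈p⇒suc∣p-x∣≡∣p∣ {p = inside ∷ p}  here          = cong (λ q → suc ∣ q ∣) (p─⊥≡p p)
x∈p⇒suc∣p-x∣≡∣p∣ {p = inside ∷ p}  (there x∈p) = cong suc (x∈p⇒suc∣p-x∣≡∣p∣ x∈p)
x∈p⇒suc∣p-x∣≡∣p∣ {p = outside ∷ p} (there x∈p) = x∈p⇒suc∣p-x∣≡∣p∣ x∈p

x∉p-x : ∀ {n} (p : Subset n) x → x ∉ₛ p - x
x∉p-x (_ ∷ p) zero    ()
x∉p-x (_ ∷ p) (suc x) (there x∈p-x) = x∉p-x p x x∈p-x

p-x≡q-x⇒p≡q : ∀ {n x} {p q : Subset n} → x ∈ₛ p → x ∈ₛ q → p - x ≡ q - x → p ≡ q
p-x≡q-x⇒p≡q {p = _ ∷ p} {_ ∷ q} here        here        eq = cong (inside ∷_) (trans (sym (p─⊥≡p p)) (trans (∷-injectiveʳ eq) (p─⊥≡p q)))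
p-x≡q-x⇒p≡q {p = _ ∷ p} {_ ∷ q} (there x∈p) (there x∈q) eq = cong₂ _∷_ (∷-injectiveˡ eq) (p-x≡q-x⇒p≡q x∈p x∈q (∷-injectiveʳ eq))

x∈p⇒1≤∣p∣ : ∀ {n x} {p : Subset n} → x ∈ₛ p → 1 ≤ ∣ p ∣
x∈p⇒1≤∣p∣ {p = inside ∷ p}  here        = s≤s z≤n
x∈p⇒1≤∣p∣ {p = inside ∷ p}  (there _)   = s≤s z≤n
x∈p⇒1≤∣p∣ {p = outside ∷ p} (there x∈p) = x∈p⇒1≤∣p∣ x∈p

∣p∣≡0⇒p≡⊥ : ∀ {n} (p : Subset n) → ∣ p ∣ ≡ 0 → p ≡ ⊥
∣p∣≡0⇒p≡⊥ []            _   = refl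
∣p∣≡0⇒p≡⊥ (outside ∷ p) ∣p∣≡0 = cong (outside ∷_) (∣p∣≡0⇒p≡⊥ p ∣p∣≡0)

∣p∣≡1⇒p≡⁅x⁆ : ∀ {n} (p : Subset n) → ∣ p ∣ ≡ 1 → ∃[ x ] p ≡ ⁅ x ⁆
∣p∣≡1⇒p≡⁅x⁆ (inside ∷ p)  ∣p∣≡1 = zero , cong (inside ∷_) (∣p∣≡0⇒p≡⊥ p (cong pred ∣p∣≡1))
∣p∣≡1⇒p≡⁅x⁆ (outside ∷ p) ∣p∣≡1 with x , refl ← ∣p∣≡1⇒p≡⁅x⁆ p ∣p∣≡1 = suc x , refl

choose : ∀ {n} → Subset n → ℕ → List (Subset n)
choose []            zero    = [ [] ]
choose []            (suc r) = []
choose (outside ∷ q) r       = map (outside ∷_) (choose q r)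
choose (inside ∷ q)  zero    = map (outside ∷_) (choose q zero)
choose (inside ∷ q)  (suc r) = map (inside ∷_) (choose q r) ++ map (outside ∷_) (choose q (suc r))

length-choose : ∀ {n} (q : Subset n) r → length (choose q r) ≡ ∣ q ∣ C r
length-choose []            zero    = refl
length-choose []            (suc r) = refl
length-choose (outside ∷ q) r       = trans (length-map _ (choose q r)) (length-choose q r)
length-choose (inside ∷ q)  zero    = trans (length-map _ (choose q zero)) (trans (length-choose q zero) (trans (nC0≡1 ∣ q ∣) (sym (nC0≡1 (suc ∣ q ∣)))))
length-choose (inside ∷ q)  (suc r) = trans (length-++ (map (inside ∷_) (choose q r)))
  (trans (cong₂ _+_ (trans (length-map _ (choose q r)) (length-choose q r)) (trans (length-map _ (choose q (suc r))) (length-choose q (suc r))))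
         (sym (pascal ∣ q ∣ r)))

∈-choose : ∀ {n} {p q : Subset n} → p ⊆ q → p ∈ choose q ∣ p ∣
∈-choose {p = []}          {[]}          _   = here refl
∈-choose {p = outside ∷ p} {outside ∷ q} p⊆q = ∈-map⁺ _ (∈-choose (drop-∷-⊆ p⊆q))
∈-choose {p = inside ∷ p}  {outside ∷ q} p⊆q with () ← p⊆q here
∈-choose {p = outside ∷ p} {inside ∷ q}  p⊆q with ∣ p ∣ | ∈-choose {p = p} (drop-∷-⊆ p⊆q)
... | zero  | p∈ = ∈-map⁺ _ p∈
... | suc r | p∈ = ∈-++⁺ʳ _ (∈-map⁺ _ p∈)
∈-choose {p = inside ∷ p}  {inside ∷ q}  p⊆q = ∈-++⁺ˡ (∈-map⁺ _ (∈-choose (drop-∷-⊆ p⊆q)))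

allSubsets : ∀ n → List (Subset n)
allSubsets zero    = [ [] ]
allSubsets (suc n) = map (inside ∷_) (allSubsets n) ++ map (outside ∷_) (allSubsets n)

length-allSubsets : ∀ n → length (allSubsets n) ≡ 2 ^ n
length-allSubsets zero    = refl
length-allSubsets (suc n) = trans (length-++ (map (inside ∷_) (allSubsets n)))
  (cong₂ _+_ (trans (length-map _ (allSubsets n)) (length-allSubsets n))
             (trans (length-map _ (allSubsets n)) (trans (length-allSubsets n) (sym (+-identityʳ _)))))

∈-allSubsets : ∀ {n} (p : Subset n) → p ∈ allSubsets n
∈-allSubsets []            = here refl
∈-allSubsets (inside ∷ p)  = ∈-++⁺ˡ (∈-map⁺ _ (∈-allSubsets p))
∈-allSubsets (outside ∷ p) = ∈-++⁺ʳ _ (∈-map⁺ _ (∈-allSubsets p))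

∣p++q∣≡∣p∣+∣q∣ : ∀ {m k} (p : Subset m) (q : Subset k) → ∣ p Vec.++ q ∣ ≡ ∣ p ∣ + ∣ q ∣
∣p++q∣≡∣p∣+∣q∣ []            q = refl
∣p++q∣≡∣p∣+∣q∣ (inside ∷ p)  q = cong suc (∣p++q∣≡∣p∣+∣q∣ p q)
∣p++q∣≡∣p∣+∣q∣ (outside ∷ p) q = ∣p++q∣≡∣p∣+∣q∣ p q

∣p∣+∣∁p∣≡n : ∀ {n} (p : Subset n) → ∣ p ∣ + ∣ ∁ p ∣ ≡ n
∣p∣+∣∁p∣≡n []            = refl
∣p∣+∣∁p∣≡n (inside ∷ p)  = cong suc (∣p∣+∣∁p∣≡n p)
∣p∣+∣∁p∣≡n (outside ∷ p) = trans (+-suc ∣ p ∣ ∣ ∁ p ∣) (cong suc (∣p∣+∣∁p∣≡n p))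

take-++ : ∀ {A : Set} {m n} (xs : Vec A m) (ys : Vec A n) → take m (xs Vec.++ ys) ≡ xs
take-++ []       ys = refl
take-++ (x ∷ xs) ys = cong (x ∷_) (take-++ xs ys)

drop-++ : ∀ {A : Set} {m n} (xs : Vec A m) (ys : Vec A n) → drop m (xs Vec.++ ys) ≡ ys
drop-++ []       ys = refl
drop-++ (x ∷ xs) ys = drop-++ xs ys

++-⊆ : ∀ {m n} {p q : Subset m} {p′ q′ : Subset n} → p ⊆ q → p′ ⊆ q′ → p Vec.++ p′ ⊆ q Vec.++ q′
++-⊆ {p = []}    {[]}    _   p′⊆q′ x∈ = p′⊆q′ x∈
++-⊆ {p = _ ∷ _} {_ ∷ _} p⊆q _ here with p⊆q here
... | here = here
++-⊆ {p = _ ∷ _} {_ ∷ _} p⊆q p′⊆q′ (there x∈) = there (++-⊆ (drop-∷-⊆ p⊆q) p′⊆q′ x∈)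

++-⊆⁻ : ∀ {m n} (p q : Subset m) {p′ q′ : Subset n} → p Vec.++ p′ ⊆ q Vec.++ q′ → p ⊆ q × p′ ⊆ q′
++-⊆⁻ []      []      pp′⊆qq′ = (λ ()) , pp′⊆qq′
++-⊆⁻ (a ∷ p) (b ∷ q) pp′⊆qq′ with p⊆q , p′⊆q′ ← ++-⊆⁻ p q (drop-∷-⊆ pp′⊆qq′) = ∷-⊆ , p′⊆q′
  where
  ∷-⊆ : a ∷ p ⊆ b ∷ q
  ∷-⊆ here with pp′⊆qq′ here
  ... | here = here
  ∷-⊆ (there x∈) = there (p⊆q x∈)

lookup-⊆ : ∀ {m} {p q : Subset m} → p ⊆ q → ∀ x → lookup p x ≡ true → lookup q x ≡ true
lookup-⊆ {p = p} p⊆q x px = []=⇒lookup (p⊆q (lookup⇒[]= x p px))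

take-drop-⊆ : ∀ n {k} {s t : Subset (n + k)} → s ⊆ t → take n s ⊆ take n t × drop n s ⊆ drop n t
take-drop-⊆ n {s = s} {t} s⊆t = ++-⊆⁻ (take n s) (take n t) (λ {x} x∈ →
  subst (λ u → x ∈ₛ u) (sym (take++drop≡id n t)) (s⊆t (subst (λ u → x ∈ₛ u) (take++drop≡id n s) x∈)))

-- Graphs as edge sets

-- The pairs of vertices of [1 + n] are listed as {0 , j + 1} for j < n, followed by the pairs of [n]
-- shifted by one.
pairs : ℕ → ℕ
pairs zero    = 0
pairs (suc n) = n + pairs n

pairs≡nC2 : ∀ n → pairs n ≡ n C 2
pairs≡nC2 zero    = refl
pairs≡nC2 (suc n) = trans (cong₂ _+_ (sym (nC1≡n n)) (pairs≡nC2 n)) (sym (pascal n 1))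

minor : ∀ {n} → Adj (suc n) → Adj n
minor (_ ∷ rows) = Vec.map tail rows

entry-minor : ∀ {n} (A : Adj (suc n)) i j → entry (minor A) i j ≡ entry A (suc i) (suc j)
entry-minor (_ ∷ rows) i j = trans (cong (λ row → lookup row j) (lookup-map i tail rows)) (lookup-tail (lookup rows i) j)
  where
  lookup-tail : ∀ {m} (row : Vec Bool (suc m)) j → lookup (tail row) j ≡ lookup row (suc j)
  lookup-tail (_ ∷ _) j = refl

edgeSet : ∀ {n} → Adj n → Subset (pairs n)
edgeSet {zero}  []                = []
edgeSet {suc n} A@((_ ∷ row) ∷ _) = row Vec.++ edgeSet (minor A)

graphOf : ∀ {n} → Subset (pairs n) → Adj n
graphOf {zero}  _ = []
graphOf {suc n} s = (false ∷ take n s) ∷ zipWith _∷_ (take n s) (graphOf (drop n s))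

entry-graphOf-suc-zero : ∀ {n} (s : Subset (pairs (suc n))) i → entry (graphOf {suc n} s) (suc i) zero ≡ lookup (take n s) i
entry-graphOf-suc-zero {n} s i = cong (λ row → lookup row zero) (lookup-zipWith _∷_ i (take n s) (graphOf {n} (drop n s)))

entry-graphOf-suc-suc : ∀ {n} (s : Subset (pairs (suc n))) i j → entry (graphOf {suc n} s) (suc i) (suc j) ≡ entry (graphOf {n} (drop n s)) i j
entry-graphOf-suc-suc {n} s i j = cong (λ row → lookup row (suc j)) (lookup-zipWith _∷_ i (take n s) (graphOf {n} (drop n s)))

graphOf-simple : ∀ {n} (s : Subset (pairs n)) → IsSimple (graphOf {n} s)
graphOf-simple s = symmetric s , loopless s
  where
  symmetric : ∀ {n} (s : Subset (pairs n)) i j → entry (graphOf {n} s) i j ≡ entry (graphOf {n} s) j i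
  symmetric s zero    zero    = refl
  symmetric s zero    (suc j) = sym (entry-graphOf-suc-zero s j)
  symmetric s (suc i) zero    = entry-graphOf-suc-zero s i
  symmetric {suc n} s (suc i) (suc j) = trans (entry-graphOf-suc-suc s i j)
    (trans (symmetric {n} (drop n s) i j) (sym (entry-graphOf-suc-suc s j i)))
  loopless : ∀ {n} (s : Subset (pairs n)) i → entry (graphOf {n} s) i i ≡ false
  loopless s zero = refl
  loopless {suc n} s (suc i) = trans (entry-graphOf-suc-suc s i i) (loopless {n} (drop n s) i)

minor-graphOf : ∀ {n} (s : Subset (pairs (suc n))) → minor (graphOf {suc n} s) ≡ graphOf {n} (drop n s)
minor-graphOf {n} s = map-tail-zipWith (take n s) (graphOf {n} (drop n s))
  where
  map-tail-zipWith : ∀ {m k} (r : Vec Bool m) (D : Vec (Vec Bool k) m) → Vec.map tail (zipWith _∷_ r D) ≡ D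
  map-tail-zipWith []      []      = refl
  map-tail-zipWith (_ ∷ r) (d ∷ D) = cong (d ∷_) (map-tail-zipWith r D)

edgeSet-graphOf : ∀ {n} (s : Subset (pairs n)) → edgeSet (graphOf {n} s) ≡ s
edgeSet-graphOf {zero}  [] = refl
edgeSet-graphOf {suc n} s  = begin
  take n s Vec.++ edgeSet (minor (graphOf {suc n} s)) ≡⟨ cong (λ A → take n s Vec.++ edgeSet A) (minor-graphOf {n} s) ⟩
  take n s Vec.++ edgeSet (graphOf {n} (drop n s))     ≡⟨ cong (take n s Vec.++_) (edgeSet-graphOf {n} (drop n s)) ⟩
  take n s Vec.++ drop n s                             ≡⟨ take++drop≡id n s ⟩
  s                                                    ∎
  where open ≡-Reasoning

graphOf-edgeSet : ∀ {n} (A : Adj n) → IsSimple A → graphOf (edgeSet A) ≡ A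
graphOf-edgeSet {zero}  [] _ = refl
graphOf-edgeSet {suc n} A@((d ∷ row) ∷ rows) (sym-A , loopless-A) = begin
  (false ∷ take n s) ∷ zipWith _∷_ (take n s) (graphOf (drop n s))
    ≡⟨ cong₂ (λ r t → (false ∷ r) ∷ zipWith _∷_ r (graphOf t)) (take-++ row (edgeSet (minor A))) (drop-++ row (edgeSet (minor A))) ⟩
  (false ∷ row) ∷ zipWith _∷_ row (graphOf (edgeSet (minor A)))
    ≡⟨ cong (λ B → (false ∷ row) ∷ zipWith _∷_ row B) (graphOf-edgeSet (minor A) minor-simple) ⟩
  (false ∷ row) ∷ zipWith _∷_ row (minor A)
    ≡⟨ cong₂ (λ b B → (b ∷ row) ∷ B) (sym (loopless-A zero)) (zipWith-head-tail row rows (λ i → sym-A zero (suc i))) ⟩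
  A ∎
  where
  open ≡-Reasoning
  s = edgeSet A
  minor-simple : IsSimple (minor A)
  minor-simple = (λ i j → trans (entry-minor A i j) (trans (sym-A (suc i) (suc j)) (sym (entry-minor A j i))))
               , (λ i → trans (entry-minor A i i) (loopless-A (suc i)))
  zipWith-head-tail : ∀ {m k} (r : Vec Bool m) (B : Vec (Vec Bool (suc k)) m) →
    (∀ i → lookup r i ≡ lookup (lookup B i) zero) → zipWith _∷_ r (Vec.map tail B) ≡ B
  zipWith-head-tail []      []              _  = refl
  zipWith-head-tail (_ ∷ r) ((_ ∷ b) ∷ B) eq = cong₂ (λ x B′ → (x ∷ b) ∷ B′) (eq zero) (zipWith-head-tail r B (λ i → eq (suc i)))

edgeSet-mono : ∀ {n} (G H : Adj n) → EdgeSub G H → edgeSet G ⊆ edgeSet H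
edgeSet-mono {zero}  []                  []                  _     x∈ = x∈
edgeSet-mono {suc n} G@((_ ∷ r) ∷ _) H@((_ ∷ r′) ∷ _) G⊆H =
  ++-⊆ row-⊆ (edgeSet-mono (minor G) (minor H) minor-⊆)
  where
  row-⊆ : r ⊆ r′
  row-⊆ {x} x∈r = lookup⇒[]= x r′ (G⊆H zero (suc x) ([]=⇒lookup x∈r))
  minor-⊆ : EdgeSub (minor G) (minor H)
  minor-⊆ i j e = trans (entry-minor H i j) (G⊆H (suc i) (suc j) (trans (sym (entry-minor G i j)) e))

graphOf-mono : ∀ {n} {s t : Subset (pairs n)} → s ⊆ t → EdgeSub (graphOf {n} s) (graphOf {n} t)
graphOf-mono {suc n} s⊆t zero    zero    ()
graphOf-mono {suc n} s⊆t zero    (suc j) e = lookup-⊆ (proj₁ (take-drop-⊆ n s⊆t)) j e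
graphOf-mono {suc n} {s} {t} s⊆t (suc i) zero e =
  trans (entry-graphOf-suc-zero t i) (lookup-⊆ (proj₁ (take-drop-⊆ n s⊆t)) i (trans (sym (entry-graphOf-suc-zero s i)) e))
graphOf-mono {suc n} {s} {t} s⊆t (suc i) (suc j) e =
  trans (entry-graphOf-suc-suc t i j) (graphOf-mono {n} (proj₂ (take-drop-⊆ n s⊆t)) i j (trans (sym (entry-graphOf-suc-suc s i j)) e))

sum-allFin-suc : ∀ {n} (f : Fin (suc n) → ℕ) → sum (map f (allFin (suc n))) ≡ f zero + sum (map (λ i → f (suc i)) (allFin n))
sum-allFin-suc f = trans (cong sum (map-tabulate (λ i → i) f)) (cong (λ xs → f zero + sum xs) (sym (map-tabulate (λ i → i) (λ i → f (suc i)))))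

sum-indicator≡∣_∣ : ∀ {n} (r : Subset n) → sum (map (λ j → if lookup r j then 1 else 0) (allFin n)) ≡ ∣ r ∣
sum-indicator≡∣ []          ∣ = refl
sum-indicator≡∣ inside ∷ r  ∣ = trans (sum-allFin-suc (λ j → if lookup (inside ∷ r) j then 1 else 0)) (cong suc (sum-indicator≡∣ r ∣))
sum-indicator≡∣ outside ∷ r ∣ = trans (sum-allFin-suc (λ j → if lookup (outside ∷ r) j then 1 else 0)) (sum-indicator≡∣ r ∣)

edgeCount≡∣edgeSet∣ : ∀ {n} (A : Adj n) → edgeCount A ≡ ∣ edgeSet A ∣
edgeCount≡∣edgeSet∣ {zero}  [] = refl
edgeCount≡∣edgeSet∣ {suc n} A@((_ ∷ r) ∷ _) = begin
  sum (map (λ i → sum (map (adjacentAbove i) (allFin (suc n)))) (allFin (suc n)))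
    ≡⟨ sum-allFin-suc (λ i → sum (map (adjacentAbove i) (allFin (suc n)))) ⟩
  sum (map (adjacentAbove zero) (allFin (suc n))) + sum (map (λ i → sum (map (adjacentAbove (suc i)) (allFin (suc n)))) (allFin n))
    ≡⟨ cong₂ _+_ (trans (sum-allFin-suc (adjacentAbove zero)) (sum-indicator≡∣ r ∣))
                 (cong sum (map-cong (λ i → trans (sum-allFin-suc (adjacentAbove (suc i))) (cong sum (map-cong (λ j →
                    cong (λ b → if does (i Fin.<? j) ∧ b then 1 else 0) (sym (entry-minor A i j))) (allFin n)))) (allFin n))) ⟩
  ∣ r ∣ + edgeCount (minor A)
    ≡⟨ cong (∣ r ∣ +_) (edgeCount≡∣edgeSet∣ (minor A)) ⟩
  ∣ r ∣ + ∣ edgeSet (minor A) ∣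
    ≡⟨ ∣p++q∣≡∣p∣+∣q∣ r (edgeSet (minor A)) ⟨
  ∣ r Vec.++ edgeSet (minor A) ∣ ∎
  where
  open ≡-Reasoning
  adjacentAbove : Fin (suc n) → Fin (suc n) → ℕ
  adjacentAbove i j = if does (i Fin.<? j) ∧ entry A i j then 1 else 0

-- Connectivity and cuts

Symmetric : ∀ {n} → Adj n → Set
Symmetric {n} A = ∀ (i j : Fin n) → entry A i j ≡ entry A j i

NoEdgeAcross : ∀ {n} → Adj n → Subset n → Set
NoEdgeAcross {n} A R = ∀ (i j : Fin n) → entry A i j ≡ true → lookup R i ≡ lookup R j

walk-++ : ∀ {n} {A : Adj n} {u v w} → Walk A u v → Walk A v w → Walk A u w
walk-++ here       q = q
walk-++ (step e p) q = step e (walk-++ p q)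

walk-reverse : ∀ {n} {A : Adj n} → Symmetric A → ∀ {u v} → Walk A u v → Walk A v u
walk-reverse sym-A here                       = here
walk-reverse sym-A {u} (step {w = w} e p) = walk-++ (walk-reverse sym-A p) (step (trans (sym-A w u) e) here)

∉⇒lookup≡false : ∀ {n} {R : Subset n} {i} → i ∉ₛ R → lookup R i ≡ false
∉⇒lookup≡false {R = R} {i} i∉R with lookup R i in eq
... | true  = ⊥-elim (i∉R (lookup⇒[]= i R eq))
... | false = refl

Cut : ∀ {n} → Adj n → Set
Cut A = ∃[ R ] (NoEdgeAcross A R × Nonempty R × Nonempty (∁ R))

private module Exploration {n} (A : Adj (suc n)) (sym-A : Symmetric A) where

  Reached : Subset (suc n) → Set
  Reached R = ∀ k → k ∈ₛ R → Walk A zero k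

  Crossing : Subset (suc n) → Set
  Crossing R = ∃[ i ] ∃[ j ] (i ∈ₛ R × entry A i j ≡ true × j ∉ₛ R)

  crossing? : ∀ R → Dec (Crossing R)
  crossing? R = any? λ i → any? λ j → (i ∈? R) ×-dec ((entry A i j Bool.≟ true) ×-dec ¬? (j ∈? R))

  no-crossing : ∀ R → ¬ Crossing R → NoEdgeAcross A R
  no-crossing R ¬cross i j e with i ∈? R | j ∈? R
  ... | yes i∈R | yes j∈R = trans ([]=⇒lookup i∈R) (sym ([]=⇒lookup j∈R))
  ... | no  i∉R | no  j∉R = trans (∉⇒lookup≡false i∉R) (sym (∉⇒lookup≡false j∉R))
  ... | yes i∈R | no  j∉R = ⊥-elim (¬cross (i , j , i∈R , e , j∉R))
  ... | no  i∉R | yes j∈R = ⊥-elim (¬cross (j , i , j∈R , trans (sym-A j i) e , i∉R))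

  grows : ∀ {R : Subset (suc n)} {j} → j ∉ₛ R → ∣ R ∣ < ∣ R ∪ ⁅ j ⁆ ∣
  grows {R} {j} j∉R = p⊂q⇒∣p∣<∣q∣ (p⊆p∪q ⁅ j ⁆ , j , x∈p∪q⁺ (inj₂ (x∈⁅x⁆ j)) , j∉R)

  conclude : ∀ R → ¬ Crossing R → zero ∈ₛ R → Reached R → Connected A ⊎ Cut A
  conclude R ¬cross 0∈R reached with nonempty? (∁ R)
  ... | yes outside-R  = inj₂ (R , no-crossing R ¬cross , (zero , 0∈R) , outside-R)
  ... | no  ¬outside-R = inj₁ λ u v → walk-++ (walk-reverse sym-A (reached u (everywhere u))) (reached v (everywhere v))
    where
    everywhere : ∀ u → u ∈ₛ R
    everywhere u = x∉∁p⇒x∈p (λ u∈∁R → ¬outside-R (u , u∈∁R))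

  explore : (fuel : ℕ) (R : Subset (suc n)) → zero ∈ₛ R → Reached R → suc n ≤ ∣ R ∣ + fuel →
            Connected A ⊎ Cut A
  explore fuel R 0∈R reached bound with crossing? R
  ... | no ¬cross = conclude R ¬cross 0∈R reached
  explore zero R _ _ bound | yes (_ , j , _ , _ , j∉R) =
    ⊥-elim (<⇒≱ (<-≤-trans (grows j∉R) (∣p∣≤n (R ∪ ⁅ j ⁆))) (≤-trans bound (≤-reflexive (+-identityʳ ∣ R ∣))))
  explore (suc fuel) R 0∈R reached bound | yes (i , j , i∈R , e , j∉R) =
    explore fuel (R ∪ ⁅ j ⁆) (p⊆p∪q ⁅ j ⁆ 0∈R) reached′
      (≤-trans bound (≤-trans (≤-reflexive (+-suc ∣ R ∣ fuel)) (+-monoˡ-≤ fuel (grows j∉R))))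
    where
    reached′ : Reached (R ∪ ⁅ j ⁆)
    reached′ k k∈ with x∈p∪q⁻ R ⁅ j ⁆ k∈
    ... | inj₁ k∈R = reached k k∈R
    ... | inj₂ k∈j with refl ← x∈⁅y⁆⇒x≡y j k∈j = walk-++ (reached i i∈R) (step e here)

  fromVertex₀ : Connected A ⊎ Cut A
  fromVertex₀ = explore n ⁅ zero ⁆ (x∈⁅x⁆ zero) (λ k k∈ → subst (Walk A zero) (sym (x∈⁅y⁆⇒x≡y zero k∈)) here)
    (≤-reflexive (cong (_+ n) (sym (∣⁅x⁆∣≡1 {suc n} zero))))

connected⊎cut : ∀ {n} (A : Adj n) → Symmetric A → Connected A ⊎ Cut A
connected⊎cut {zero}  _ _     = inj₁ λ ()
connected⊎cut {suc n} A sym-A = Exploration.fromVertex₀ A sym-A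

data Disconnection {n} (A : Adj n) : Set where
  isolated : ∀ w → NoEdgeAcross A ⁅ w ⁆ → Disconnection A
  balanced : ∀ R → 2 ≤ ∣ R ∣ → 2 ≤ ∣ ∁ R ∣ → NoEdgeAcross A R → Disconnection A

NoEdgeAcross-∁ : ∀ {n} {A : Adj n} {R} → NoEdgeAcross A R → NoEdgeAcross A (∁ R)
NoEdgeAcross-∁ {R = R} no-edge i j e = trans (lookup-map i not R) (trans (cong not (no-edge i j e)) (sym (lookup-map j not R)))

cut⇒disconnection : ∀ {n} {A : Adj n} → Cut A → Disconnection A
cut⇒disconnection {A = A} (R , no-edge , (_ , x∈R) , (_ , y∈∁R)) = classify (∣ R ∣) refl (∣ ∁ R ∣) refl
  where
  singleton : ∀ S → NoEdgeAcross A S → ∣ S ∣ ≡ 1 → Disconnection A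
  singleton S no-edge′ ∣S∣≡1 with w , S≡⁅w⁆ ← ∣p∣≡1⇒p≡⁅x⁆ S ∣S∣≡1 = isolated w (subst (NoEdgeAcross A) S≡⁅w⁆ no-edge′)
  classify : ∀ a → ∣ R ∣ ≡ a → ∀ b → ∣ ∁ R ∣ ≡ b → Disconnection A
  classify zero    eq _ _ with () ← subst (1 ≤_) eq (x∈p⇒1≤∣p∣ x∈R)
  classify (suc zero) eq _ _ = singleton R no-edge eq
  classify (suc (suc a)) _ zero    eq with () ← subst (1 ≤_) eq (x∈p⇒1≤∣p∣ y∈∁R)
  classify (suc (suc a)) _ (suc zero) eq = singleton (∁ R) (NoEdgeAcross-∁ {A = A} {R} no-edge) eq
  classify (suc (suc a)) eqa (suc (suc b)) eqb =
    balanced R (subst (2 ≤_) (sym eqa) (s≤s (s≤s z≤n))) (subst (2 ≤_) (sym eqb) (s≤s (s≤s z≤n))) no-edge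

-- sideGraph R has loops, which edgeSet ignores.
sideGraph : ∀ {n} → Subset n → Adj n
sideGraph R = tabulate λ i → tabulate λ j → does (lookup R i Bool.≟ lookup R j)

NoEdgeAcross⇒⊆sideGraph : ∀ {n} {G : Adj n} {R} → NoEdgeAcross G R → EdgeSub G (sideGraph R)
NoEdgeAcross⇒⊆sideGraph {R = R} no-edge i j e = begin
  entry (sideGraph R) i j                    ≡⟨ trans (cong (λ row → lookup row j) (lookup∘tabulate _ i)) (lookup∘tabulate _ j) ⟩
  does (lookup R i Bool.≟ lookup R j)        ≡⟨ cong (λ b → does (lookup R i Bool.≟ b)) (no-edge i j e) ⟨
  does (lookup R i Bool.≟ lookup R i)        ≡⟨ dec-true (lookup R i Bool.≟ lookup R i) refl ⟩
  true                                       ∎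
  where open ≡-Reasoning

∣edgeSet-sideGraph∣+∣R∣*∣∁R∣≡pairs : ∀ {n} (R : Subset n) → ∣ edgeSet (sideGraph R) ∣ + ∣ R ∣ * ∣ ∁ R ∣ ≡ pairs n
∣edgeSet-sideGraph∣+∣R∣*∣∁R∣≡pairs []      = refl
∣edgeSet-sideGraph∣+∣R∣*∣∁R∣≡pairs {suc n} (b ∷ R) = begin
  ∣ row b Vec.++ edgeSet (minor (sideGraph (b ∷ R))) ∣ + ∣ b ∷ R ∣ * ∣ ∁ (b ∷ R) ∣
    ≡⟨ cong (λ (A : Adj n) → ∣ row b Vec.++ edgeSet A ∣ + ∣ b ∷ R ∣ * ∣ ∁ (b ∷ R) ∣) (sym (tabulate-∘ Vec.tail _)) ⟩
  ∣ row b Vec.++ edgeSet (sideGraph R) ∣ + ∣ b ∷ R ∣ * ∣ ∁ (b ∷ R) ∣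
    ≡⟨ cong (_+ ∣ b ∷ R ∣ * ∣ ∁ (b ∷ R) ∣) (∣p++q∣≡∣p∣+∣q∣ (row b) (edgeSet (sideGraph R))) ⟩
  ∣ row b ∣ + ∣ edgeSet (sideGraph R) ∣ + ∣ b ∷ R ∣ * ∣ ∁ (b ∷ R) ∣
    ≡⟨ split b (∣ edgeSet (sideGraph R) ∣) ⟩
  (∣ R ∣ + ∣ ∁ R ∣) + (∣ edgeSet (sideGraph R) ∣ + ∣ R ∣ * ∣ ∁ R ∣)
    ≡⟨ cong₂ _+_ (∣p∣+∣∁p∣≡n R) (∣edgeSet-sideGraph∣+∣R∣*∣∁R∣≡pairs R) ⟩
  n + pairs n ∎
  where
  open ≡-Reasoning
  row : Bool → Subset n
  row b = tabulate λ j → does (b Bool.≟ lookup R j)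
  ∣row∣ : ∀ {m} (R : Subset m) → ∣ tabulate (λ j → does (inside Bool.≟ lookup R j)) ∣ ≡ ∣ R ∣
                               × ∣ tabulate (λ j → does (outside Bool.≟ lookup R j)) ∣ ≡ ∣ ∁ R ∣
  ∣row∣ []            = refl , refl
  ∣row∣ (inside ∷ R)  = let (eq₁ , eq₂) = ∣row∣ R in cong suc eq₁ , eq₂
  ∣row∣ (outside ∷ R) = let (eq₁ , eq₂) = ∣row∣ R in eq₁ , cong suc eq₂
  split : ∀ b T → ∣ row b ∣ + T + ∣ b ∷ R ∣ * ∣ ∁ (b ∷ R) ∣ ≡ (∣ R ∣ + ∣ ∁ R ∣) + (T + ∣ R ∣ * ∣ ∁ R ∣)
  split inside  T rewrite proj₁ (∣row∣ R) =
    solve 3 (λ a c t → a :+ t :+ (con 1 :+ a) :* c := (a :+ c) :+ (t :+ a :* c)) refl ∣ R ∣ ∣ ∁ R ∣ T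
  split outside T rewrite proj₂ (∣row∣ R) =
    solve 3 (λ a c t → c :+ t :+ a :* (con 1 :+ c) := (a :+ c) :+ (t :+ a :* c)) refl ∣ R ∣ ∣ ∁ R ∣ T

-- Double counting

2*[a+b∸2]≤a*b : ∀ {a b} → 2 ≤ a → 2 ≤ b → 2 * (a + b ∸ 2) ≤ a * b
2*[a+b∸2]≤a*b {suc (suc a)} {suc (suc b)} (s≤s (s≤s _)) (s≤s (s≤s _)) = begin
  2 * (a + suc (suc b))      ≡⟨ solve 2 (λ a b → con 2 :* (a :+ (con 2 :+ b)) := con 4 :+ con 2 :* a :+ con 2 :* b) refl a b ⟩
  4 + 2 * a + 2 * b          ≤⟨ m≤m+n _ (a * b) ⟩
  4 + 2 * a + 2 * b + a * b  ≡⟨ solve 2 (λ a b → con 4 :+ con 2 :* a :+ con 2 :* b :+ a :* b := (con 2 :+ a) :* (con 2 :+ b)) refl a b ⟩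
  suc (suc a) * suc (suc b)  ∎
  where open ≤-Reasoning

module _ {n k : ℕ} (Xs : List (Adj n)) (Xs! : Unique Xs) (Xs⊆𝒢 : All (InG n k) Xs)
         (S : List (Adj n)) (S-enum : Enumerates S (Shadow n k Xs)) where

  private
    m = pairs n
    K = k ∸ 1

    Item : Set
    Item = Adj n × Fin m

    items : List Item
    items = Xs ⋉ (elements ∘ edgeSet)

    remainder : Item → Subset m
    remainder (H , e) = edgeSet H - e

    key : Item → Subset m × Fin m
    key x = remainder x , proj₂ x

    ∣edgeSet∣≡k : ∀ {H} → H ∈ Xs → ∣ edgeSet H ∣ ≡ k
    ∣edgeSet∣≡k {H} H∈Xs = trans (sym (edgeCount≡∣edgeSet∣ H)) (proj₂ (proj₂ (All.lookup Xs⊆𝒢 H∈Xs)))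

    item⁻ : ∀ {H e} → (H , e) ∈ items → H ∈ Xs × e ∈ₛ edgeSet H
    item⁻ x∈ = let H∈Xs , e∈ = ∈-⋉⁻ x∈ in H∈Xs , ∈-elements⁻ e∈

    length-items : length items ≡ length Xs * k
    length-items = length-⋉ Xs _ (All.tabulate λ {H} H∈Xs → trans (length-elements (edgeSet H)) (∣edgeSet∣≡k H∈Xs))

    key-injective : ∀ {x y} → x ∈ items → y ∈ items → key x ≡ key y → x ≡ y
    key-injective {H , e} {H′ , _} x∈ y∈ eq with refl ← ,-injectiveʳ eq = cong (_, e) (begin
      H                     ≡⟨ graphOf-edgeSet H (proj₁ (All.lookup Xs⊆𝒢 H∈Xs)) ⟨
      graphOf (edgeSet H)   ≡⟨ cong graphOf (p-x≡q-x⇒p≡q e∈H e∈H′ (,-injectiveˡ eq)) ⟩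
      graphOf (edgeSet H′)  ≡⟨ graphOf-edgeSet H′ (proj₁ (All.lookup Xs⊆𝒢 H′∈Xs)) ⟩
      H′                    ∎)
      where
      open ≡-Reasoning
      H∈Xs = proj₁ (item⁻ x∈)
      e∈H = proj₂ (item⁻ x∈)
      H′∈Xs = proj₁ (item⁻ y∈)
      e∈H′ = proj₂ (item⁻ y∈)

    ∣remainder∣ : ∀ {x} → x ∈ items → ∣ remainder x ∣ ≡ K
    ∣remainder∣ x∈ = cong pred (trans (x∈p⇒suc∣p-x∣≡∣p∣ (proj₂ (item⁻ x∈))) (∣edgeSet∣≡k (proj₁ (item⁻ x∈))))

    remainder∈S : ∀ {x} → x ∈ items → Connected (graphOf {n} (remainder x)) → graphOf {n} (remainder x) ∈ S
    remainder∈S {H , e} x∈ connected = Equivalence.from (proj₂ S-enum (graphOf {n} g))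
      ((graphOf-simple {n} g , connected , edgeCount≡K) , H , H∈Xs , g⊆H)
      where
      g = remainder (H , e)
      H∈Xs = proj₁ (item⁻ x∈)
      edgeCount≡K : edgeCount (graphOf {n} g) ≡ K
      edgeCount≡K = trans (edgeCount≡∣edgeSet∣ (graphOf {n} g)) (trans (cong ∣_∣ (edgeSet-graphOf {n} g)) (∣remainder∣ x∈))
      g⊆H : EdgeSub (graphOf {n} g) H
      g⊆H = subst (EdgeSub (graphOf {n} g)) (graphOf-edgeSet H (proj₁ (All.lookup Xs⊆𝒢 H∈Xs))) (graphOf-mono {n} (p─q⊆p (edgeSet H) ⁅ e ⁆))

    ∣edgeSet∣≡K : ∀ {G} → G ∈ S → ∣ edgeSet G ∣ ≡ K
    ∣edgeSet∣≡K {G} G∈S = trans (sym (edgeCount≡∣edgeSet∣ G)) (proj₂ (proj₂ (proj₁ (Equivalence.to (proj₂ S-enum G) G∈S))))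

    side : Subset n → Subset m
    side R = edgeSet (sideGraph R)

    ∣side∣ : ∀ R → ∣ side R ∣ ≡ m ∸ ∣ R ∣ * ∣ ∁ R ∣
    ∣side∣ R = trans (sym (m+n∸n≡m _ (∣ R ∣ * ∣ ∁ R ∣))) (cong (_∸ ∣ R ∣ * ∣ ∁ R ∣) (∣edgeSet-sideGraph∣+∣R∣*∣∁R∣≡pairs R))

    connectedTargets isolatedTargets balancedTargets targets : List (Subset m × Fin m)
    connectedTargets = map edgeSet S ⋉ (elements ∘ ∁)
    isolatedTargets  = concatMap (λ w → choose (side ⁅ w ⁆) K) (allFin n) ⋉ const (allFin m)
    balancedTargets  = concatMap (λ R → choose (side R) K) (filter (λ R → (2 ≤? ∣ R ∣) ×-dec (2 ≤? ∣ ∁ R ∣)) (allSubsets n))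
                       ⋉ const (allFin m)
    targets = connectedTargets ++ isolatedTargets ++ balancedTargets

    remainder∈choose : ∀ {x R} → x ∈ items → NoEdgeAcross (graphOf {n} (remainder x)) R → remainder x ∈ choose (side R) K
    remainder∈choose {x} {R} x∈ no-edge = subst (λ r → remainder x ∈ choose (side R) r) (∣remainder∣ x∈)
      (∈-choose (subst (_⊆ side R) (edgeSet-graphOf {n} (remainder x))
        (edgeSet-mono (graphOf {n} (remainder x)) (sideGraph R) (NoEdgeAcross⇒⊆sideGraph {G = graphOf {n} (remainder x)} {R = R} no-edge))))

    key∈targets : ∀ {x} → x ∈ items → key x ∈ targets
    key∈targets {H , e} x∈ with connected⊎cut (graphOf {n} (remainder (H , e))) (proj₁ (graphOf-simple {n} (remainder (H , e))))
    ... | inj₁ connected =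
      ∈-++⁺ˡ (∈-⋉ (subst (_∈ map edgeSet S) (edgeSet-graphOf {n} _) (∈-map⁺ edgeSet (remainder∈S x∈ connected)))
                  (∈-elements⁺ (x∉p⇒x∈∁p (x∉p-x (edgeSet H) e))))
    ... | inj₂ cut with cut⇒disconnection {A = graphOf {n} (remainder (H , e))} cut
    ...   | isolated w no-edge =
      ∈-++⁺ʳ connectedTargets (∈-++⁺ˡ (∈-⋉ (∈-concatMap _ (∈-allFin w) (remainder∈choose {R = ⁅ w ⁆} x∈ no-edge)) (∈-allFin e)))
    ...   | balanced R 2≤∣R∣ 2≤∣∁R∣ no-edge =
      ∈-++⁺ʳ connectedTargets (∈-++⁺ʳ isolatedTargets
        (∈-⋉ (∈-concatMap _ (∈-filter⁺ _ (∈-allSubsets R) (2≤∣R∣ , 2≤∣∁R∣)) (remainder∈choose {R = R} x∈ no-edge)) (∈-allFin e)))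

    length-connectedTargets : length connectedTargets ≤ length S * (m ∸ K)
    length-connectedTargets = begin
      length connectedTargets           ≤⟨ length-concatMap-≤ _ (map edgeSet S) (All.map⁺ (All.tabulate λ G∈S → ≤-reflexive (fibre G∈S))) ⟩
      length (map edgeSet S) * (m ∸ K)  ≡⟨ cong (_* (m ∸ K)) (length-map edgeSet S) ⟩
      length S * (m ∸ K)                ∎
      where
      open ≤-Reasoning
      fibre : ∀ {G} → G ∈ S → length (map (edgeSet G ,_) (elements (∁ (edgeSet G)))) ≡ m ∸ K
      fibre {G} G∈S = trans (length-map _ (elements (∁ (edgeSet G))))
        (trans (length-elements (∁ (edgeSet G))) (trans (∣∁p∣≡n∸∣p∣ (edgeSet G)) (cong (m ∸_) (∣edgeSet∣≡K G∈S))))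

    length-⋉allFin : (gs : List (Subset m)) → length (gs ⋉ const (allFin m)) ≡ length gs * m
    length-⋉allFin gs = length-⋉ gs _ (All.universal (λ _ → length-tabulate (λ i → i)) gs)

    length-isolatedTargets : length isolatedTargets ≤ m * n * ((m ∸ (n ∸ 1)) C K)
    length-isolatedTargets = begin
      length isolatedTargets                        ≡⟨ length-⋉allFin (concatMap (λ w → choose (side ⁅ w ⁆) K) (allFin n)) ⟩
      length (concatMap (λ w → choose (side ⁅ w ⁆) K) (allFin n)) * m
        ≤⟨ *-monoˡ-≤ m (length-concatMap-≤ _ (allFin n) (All.universal (λ w → ≤-reflexive (fibre w)) _)) ⟩
      length (allFin n) * ((m ∸ (n ∸ 1)) C K) * m   ≡⟨ cong (λ l → l * ((m ∸ (n ∸ 1)) C K) * m) (length-tabulate {n = n} (λ i → i)) ⟩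
      n * ((m ∸ (n ∸ 1)) C K) * m                   ≡⟨ solve 3 (λ n c m → n :* c :* m := m :* n :* c) refl n _ m ⟩
      m * n * ((m ∸ (n ∸ 1)) C K)                   ∎
      where
      open ≤-Reasoning
      fibre : ∀ w → length (choose (side ⁅ w ⁆) K) ≡ (m ∸ (n ∸ 1)) C K
      fibre w = trans (length-choose (side ⁅ w ⁆) K) (cong (_C K) (trans (∣side∣ ⁅ w ⁆) (cong (m ∸_) (begin-equality
        ∣ ⁅ w ⁆ ∣ * ∣ ∁ ⁅ w ⁆ ∣  ≡⟨ cong₂ _*_ (∣⁅x⁆∣≡1 w) (trans (∣∁p∣≡n∸∣p∣ ⁅ w ⁆) (cong (n ∸_) (∣⁅x⁆∣≡1 w))) ⟩
        1 * (n ∸ 1)              ≡⟨ *-identityˡ (n ∸ 1) ⟩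
        n ∸ 1                    ∎))))

    length-balancedTargets : length balancedTargets ≤ m * 2 ^ n * ((m ∸ 2 * (n ∸ 2)) C K)
    length-balancedTargets = begin
      length balancedTargets                ≡⟨ length-⋉allFin (concatMap (λ R → choose (side R) K) balancedSides) ⟩
      length (concatMap (λ R → choose (side R) K) balancedSides) * m
        ≤⟨ *-monoˡ-≤ m (length-concatMap-≤ _ balancedSides (All.tabulate fibre)) ⟩
      length balancedSides * C₂ * m         ≤⟨ *-monoˡ-≤ m (*-monoˡ-≤ C₂ (≤-trans (length-filter _ (allSubsets n)) (≤-reflexive (length-allSubsets n)))) ⟩
      2 ^ n * C₂ * m                        ≡⟨ solve 3 (λ p c m → p :* c :* m := m :* p :* c) refl (2 ^ n) C₂ m ⟩
      m * 2 ^ n * C₂                        ∎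
      where
      open ≤-Reasoning
      C₂ = (m ∸ 2 * (n ∸ 2)) C K
      balancedSides = filter (λ R → (2 ≤? ∣ R ∣) ×-dec (2 ≤? ∣ ∁ R ∣)) (allSubsets n)
      fibre : ∀ {R} → R ∈ balancedSides → length (choose (side R) K) ≤ C₂
      fibre {R} R∈ with 2≤∣R∣ , 2≤∣∁R∣ ← proj₂ (∈-filter⁻ _ {xs = allSubsets n} R∈) =
        ≤-trans (≤-reflexive (length-choose (side R) K)) (C-monoˡ-≤ K (begin
          ∣ side R ∣                   ≡⟨ ∣side∣ R ⟩
          m ∸ ∣ R ∣ * ∣ ∁ R ∣          ≤⟨ ∸-monoʳ-≤ m (subst (λ x → 2 * (x ∸ 2) ≤ ∣ R ∣ * ∣ ∁ R ∣) (∣p∣+∣∁p∣≡n R) (2*[a+b∸2]≤a*b 2≤∣R∣ 2≤∣∁R∣)) ⟩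
          m ∸ 2 * (n ∸ 2)              ∎))

    count : length Xs * k ≤ length S * (m ∸ K) + m * n * ((m ∸ (n ∸ 1)) C K) + m * 2 ^ n * ((m ∸ 2 * (n ∸ 2)) C K)
    count = begin
      length Xs * k             ≡⟨ length-items ⟨
      length items              ≡⟨ length-map key items ⟨
      length (map key items)    ≤⟨ Unique⇒length≤ (Unique-map⁺ key-injective (⋉⁺ Xs! (λ _ → Unique-elements)))
                                                   (All.map⁺ (All.tabulate key∈targets)) ⟩
      length targets            ≡⟨ trans (length-++ connectedTargets) (cong (length connectedTargets +_) (length-++ isolatedTargets)) ⟩
      length connectedTargets + (length isolatedTargets + length balancedTargets)
        ≤⟨ +-mono-≤ length-connectedTargets (+-mono-≤ length-isolatedTargets length-balancedTargets) ⟩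
      length S * (m ∸ K) + (m * n * ((m ∸ (n ∸ 1)) C K) + m * 2 ^ n * ((m ∸ 2 * (n ∸ 2)) C K))
        ≡⟨ +-assoc (length S * (m ∸ K)) _ _ ⟨
      length S * (m ∸ K) + m * n * ((m ∸ (n ∸ 1)) C K) + m * 2 ^ n * ((m ∸ 2 * (n ∸ 2)) C K) ∎
      where open ≤-Reasoning

  shadow-double-count : length Xs * k ≤ length S * (n C 2 ∸ (k ∸ 1)) + (n C 2) * n * ((n C 2 ∸ (n ∸ 1)) C (k ∸ 1))
                                         + (n C 2) * 2 ^ n * ((n C 2 ∸ 2 * (n ∸ 2)) C (k ∸ 1))
  shadow-double-count = subst (λ m → length Xs * k ≤ length S * (m ∸ K) + m * n * ((m ∸ (n ∸ 1)) C K) + m * 2 ^ n * ((m ∸ 2 * (n ∸ 2)) C K))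
                              (pairs≡nC2 n) count

-- Estimates

x*[1+K]≤s*K+B⇒B<x⇒x<s : ∀ {x s K B} → x * suc K ≤ s * K + B → B < x → x < s
x*[1+K]≤s*K+B⇒B<x⇒x<s {x} {s} {K} {B} count B<x = *-cancelʳ-< K x s (+-cancelʳ-< x (x * K) (s * K) (begin-strict
  x * K + x    ≡⟨ trans (+-comm (x * K) x) (sym (*-suc x K)) ⟩
  x * suc K    ≤⟨ count ⟩
  s * K + B    <⟨ +-monoʳ-< (s * K) B<x ⟩
  s * K + x    ∎))
  where open ≤-Reasoning

n<2^n : ∀ n → n < 2 ^ n
n<2^n zero    = s≤s z≤n
n<2^n (suc n) = +-mono-≤ (m^n>0 2 n) (≤-trans (n<2^n n) (≤-reflexive (sym (+-identityʳ (2 ^ n)))))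

[s+4]^3≤2*[s+3]^3 : ∀ s → 1 ≤ s → (s + 4) ^ 3 ≤ 2 * (s + 3) ^ 3
[s+4]^3≤2*[s+3]^3 (suc u) _ = ≤-trans (m≤m+n ((suc u + 4) ^ 3) (u ^ 3 + 9 * u ^ 2 + 21 * u + 3))
  (≤-reflexive (solve 1 (λ x → ((con 1 :+ x) :+ con 4) :^ 3 :+ (x :^ 3 :+ con 9 :* x :^ 2 :+ con 21 :* x :+ con 3)
                              := con 2 :* ((con 1 :+ x) :+ con 3) :^ 3) refl u))

Q^3*[64Q+d+3]^3<2^[64Q+d] : ∀ {Q} → 1 ≤ Q → ∀ d → Q ^ 3 * (64 * Q + d + 3) ^ 3 < 2 ^ (64 * Q + d)
Q^3*[64Q+d+3]^3<2^[64Q+d] {Q} 1≤Q zero = begin-strict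
  Q ^ 3 * (64 * Q + 0 + 3) ^ 3          ≤⟨ *-mono-≤ (^-monoˡ-≤ 3 (<⇒≤ (n<2^n Q))) (^-monoˡ-≤ 3 64Q+3≤2^[7+Q]) ⟩
  (2 ^ Q) ^ 3 * (2 ^ (7 + Q)) ^ 3       ≡⟨ cong₂ _*_ (^-*-assoc 2 Q 3) (^-*-assoc 2 (7 + Q) 3) ⟩
  2 ^ (Q * 3) * 2 ^ ((7 + Q) * 3)       ≡⟨ ^-distribˡ-+-* 2 (Q * 3) ((7 + Q) * 3) ⟨
  2 ^ (Q * 3 + (7 + Q) * 3)             <⟨ ^-monoʳ-< 2 (s≤s (s≤s z≤n)) exponent ⟩
  2 ^ (64 * Q + 0)                      ∎
  where
  open ≤-Reasoning
  64Q+3≤2^[7+Q] : 64 * Q + 0 + 3 ≤ 2 ^ (7 + Q)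
  64Q+3≤2^[7+Q] = begin
    64 * Q + 0 + 3     ≤⟨ +-monoʳ-≤ (64 * Q + 0) (≤-trans (s≤s (s≤s (s≤s z≤n))) (*-monoʳ-≤ 64 1≤Q)) ⟩
    64 * Q + 0 + 64 * Q ≡⟨ solve 1 (λ x → con 64 :* x :+ con 0 :+ con 64 :* x := con 128 :* x) refl Q ⟩
    128 * Q            ≤⟨ *-monoʳ-≤ 128 (<⇒≤ (n<2^n Q)) ⟩
    2 ^ 7 * 2 ^ Q      ≡⟨ ^-distribˡ-+-* 2 7 Q ⟨
    2 ^ (7 + Q)        ∎
  exponent : Q * 3 + (7 + Q) * 3 < 64 * Q + 0
  exponent = begin
    suc (Q * 3 + (7 + Q) * 3)  ≡⟨ solve 1 (λ x → con 1 :+ (x :* con 3 :+ (con 7 :+ x) :* con 3) := con 22 :+ con 6 :* x) refl Q ⟩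
    22 + 6 * Q                 ≤⟨ +-monoˡ-≤ (6 * Q) (*-monoʳ-≤ 22 1≤Q) ⟩
    22 * Q + 6 * Q             ≡⟨ solve 1 (λ x → con 22 :* x :+ con 6 :* x := con 28 :* x) refl Q ⟩
    28 * Q                     ≤⟨ *-monoˡ-≤ Q (m≤m+n 28 36) ⟩
    64 * Q                     ≡⟨ +-identityʳ _ ⟨
    64 * Q + 0                 ∎
Q^3*[64Q+d+3]^3<2^[64Q+d] {Q} 1≤Q (suc d) = begin-strict
  Q ^ 3 * (64 * Q + suc d + 3) ^ 3  ≡⟨ cong (λ x → Q ^ 3 * x ^ 3) (trans (cong (_+ 3) (+-suc (64 * Q) d)) (sym (+-suc s 3))) ⟩
  Q ^ 3 * (s + 4) ^ 3               ≤⟨ *-monoʳ-≤ (Q ^ 3) ([s+4]^3≤2*[s+3]^3 s (≤-trans 1≤Q (≤-trans (m≤n*m Q 64) (m≤m+n _ d)))) ⟩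
  Q ^ 3 * (2 * (s + 3) ^ 3)         ≡⟨ solve 2 (λ c y → c :* (con 2 :* y) := con 2 :* (c :* y)) refl (Q ^ 3) ((s + 3) ^ 3) ⟩
  2 * (Q ^ 3 * (s + 3) ^ 3)         <⟨ *-monoʳ-< 2 (Q^3*[64Q+d+3]^3<2^[64Q+d] 1≤Q d) ⟩
  2 * 2 ^ s                         ≡⟨ cong (2 ^_) (+-suc (64 * Q) d) ⟨
  2 ^ (64 * Q + suc d)              ∎
  where
  open ≤-Reasoning
  s = 64 * Q + d

n≤2⌈n/2⌉≤1+n : ∀ n → n ≤ 2 * ⌈ n /2⌉ × 2 * ⌈ n /2⌉ ≤ suc n
n≤2⌈n/2⌉≤1+n zero          = z≤n , z≤n
n≤2⌈n/2⌉≤1+n (suc zero)    = s≤s z≤n , ≤-refl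
n≤2⌈n/2⌉≤1+n (suc (suc n)) with lower , upper ← n≤2⌈n/2⌉≤1+n n =
  ≤-trans (s≤s (s≤s lower)) (≤-reflexive (sym (2*[1+x]≡2+2x _))) , ≤-trans (≤-reflexive (2*[1+x]≡2+2x _)) (s≤s (s≤s upper))
  where
  2*[1+x]≡2+2x : ∀ x → 2 * suc x ≡ suc (suc (2 * x))
  2*[1+x]≡2+2x x = solve 1 (λ y → con 2 :* (con 1 :+ y) := con 2 :+ con 2 :* y) refl x

middle-layer-bounds : ∀ {n′ N K} → 3 * n′ ≤ N → ⌈ (n′ + N) /2⌉ + 1 ≤ suc K → suc K < ⌈ (n′ + N) /2⌉ + suc n′ →
                      n′ + N ≤ 2 * K × suc K ≤ N
middle-layer-bounds {n′} {N} {K} 3n′≤N k-low k-high = m≤2K , k≤N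
  where
  open ≤-Reasoning
  m = n′ + N
  c = ⌈ m /2⌉
  m≤2K : m ≤ 2 * K
  m≤2K = ≤-trans (proj₁ (n≤2⌈n/2⌉≤1+n m)) (*-monoʳ-≤ 2 (≤-pred (≤-trans (≤-reflexive (+-comm 1 c)) k-low)))
  k≤N : suc K ≤ N
  k≤N = ≤-pred (*-cancelˡ-< 2 (suc K) (suc N) (+-cancelʳ-≤ 2 (suc (2 * suc K)) (2 * suc N) (begin
    suc (2 * suc K) + 2      ≡⟨ solve 1 (λ x → con 1 :+ con 2 :* x :+ con 2 := con 2 :* (con 1 :+ x) :+ con 1) refl (suc K) ⟩
    2 * suc (suc K) + 1      ≤⟨ +-monoˡ-≤ 1 (*-monoʳ-≤ 2 k-high) ⟩
    2 * (c + suc n′) + 1     ≡⟨ solve 2 (λ x y → con 2 :* (x :+ (con 1 :+ y)) :+ con 1 := con 2 :* x :+ (con 2 :* y :+ con 3)) refl c n′ ⟩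
    2 * c + (2 * n′ + 3)     ≤⟨ +-monoˡ-≤ (2 * n′ + 3) (proj₂ (n≤2⌈n/2⌉≤1+n m)) ⟩
    suc m + (2 * n′ + 3)     ≡⟨ solve 2 (λ x y → con 1 :+ (x :+ y) :+ (con 2 :* x :+ con 3) := con 3 :* x :+ y :+ con 4) refl n′ N ⟩
    3 * n′ + N + 4           ≤⟨ +-monoˡ-≤ 4 (+-monoˡ-≤ N 3n′≤N) ⟩
    N + N + 4                ≡⟨ solve 1 (λ y → y :+ y :+ con 4 := con 2 :* (con 1 :+ y) :+ con 2) refl N ⟩
    2 * suc N + 2            ∎)))

3n≤nC2 : ∀ {n} → 9 ≤ n → 3 * n ≤ n C 2
3n≤nC2 {n} 9≤n = *-cancelˡ-≤ 2 (+-cancelʳ-≤ n (2 * (3 * n)) (2 * (n C 2)) (begin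
  2 * (3 * n) + n    ≡⟨ solve 1 (λ x → con 2 :* (con 3 :* x) :+ x := con 7 :* x) refl n ⟩
  7 * n              ≤⟨ *-monoˡ-≤ n (≤-trans (m≤m+n 7 2) 9≤n) ⟩
  n * n              ≡⟨ 2*nC2+n≡n*n n ⟨
  2 * (n C 2) + n    ∎))
  where open ≤-Reasoning

module _ (Q : ℕ) .{{_ : NonZero Q}} {n′ : ℕ} where

  private
    t = suc n′ / Q

  64Q+2≤[1+n′]/Q : Q * (64 * Q + 2) ≤ n′ → 64 * Q + 2 ≤ t
  64Q+2≤[1+n′]/Q Q[64Q+2]≤n′ = ≤-trans (≤-reflexive (sym (m*n/n≡m (64 * Q + 2) Q)))
    (/-monoˡ-≤ Q (≤-trans (≤-reflexive (*-comm (64 * Q + 2) Q)) (≤-trans Q[64Q+2]≤n′ (n≤1+n n′))))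

  [1+n′]/Q≤n′ : 2 ≤ Q → 1 ≤ t → t ≤ n′
  [1+n′]/Q≤n′ 2≤Q 1≤t = ≤-pred (begin
    suc t      ≤⟨ +-monoˡ-≤ t 1≤t ⟩
    t + t      ≡⟨ solve 1 (λ x → x :+ x := x :* con 2) refl t ⟩
    t * 2      ≤⟨ *-monoʳ-≤ t 2≤Q ⟩
    t * Q      ≤⟨ m/n*n≤m (suc n′) Q ⟩
    suc n′     ∎)
    where open ≤-Reasoning

  [n′+n′C2]*[n+8]<2^[t∸1] : Q * (64 * Q + 2) + 9 ≤ n′ → (n′ + n′ C 2) * (suc n′ + 8) < 2 ^ (t ∸ 1)
  [n′+n′C2]*[n+8]<2^[t∸1] threshold≤n′ with d , t≡64Q+2+d ← m≤n⇒∃[o]m+o≡n (64Q+2≤[1+n′]/Q (≤-trans (m≤m+n _ 9) threshold≤n′)) =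
    begin-strict
    (n′ + N) * (suc n′ + 8)      ≤⟨ *-mono-≤ m≤n′² n+8≤2n′ ⟩
    n′ * n′ * (2 * n′)           ≡⟨ solve 1 (λ x → x :* x :* (con 2 :* x) := con 2 :* x :^ 3) refl n′ ⟩
    2 * n′ ^ 3                   ≤⟨ *-monoʳ-≤ 2 n′³≤ ⟩
    2 * (Q ^ 3 * (s + 3) ^ 3)    <⟨ *-monoʳ-< 2 (Q^3*[64Q+d+3]^3<2^[64Q+d] 1≤Q d) ⟩
    2 * 2 ^ s                    ≡⟨ cong (λ x → 2 ^ (x ∸ 1)) t≡2+s ⟨
    2 ^ (t ∸ 1)                  ∎
    where
    open ≤-Reasoning
    N = n′ C 2
    s = 64 * Q + d
    1≤Q : 1 ≤ Q
    1≤Q = >-nonZero⁻¹ Q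
    9≤n′ : 9 ≤ n′
    9≤n′ = ≤-trans (m≤n+m 9 _) threshold≤n′
    t≡2+s : t ≡ 2 + s
    t≡2+s = trans (sym t≡64Q+2+d) (solve 2 (λ x y → con 64 :* x :+ con 2 :+ y := con 2 :+ (con 64 :* x :+ y)) refl Q d)
    m≤n′² : n′ + N ≤ n′ * n′
    m≤n′² = ≤-trans (+-monoʳ-≤ n′ (m≤n+m N N))
      (≤-reflexive (trans (+-comm n′ (N + N)) (trans (cong (_+ n′) (cong (N +_) (sym (+-identityʳ N)))) (2*nC2+n≡n*n n′))))
    n+8≤2n′ : suc n′ + 8 ≤ 2 * n′
    n+8≤2n′ = ≤-trans (≤-reflexive (solve 1 (λ x → (con 1 :+ x) :+ con 8 := x :+ con 9) refl n′))
                (≤-trans (+-monoʳ-≤ n′ 9≤n′) (≤-reflexive (solve 1 (λ x → x :+ x := con 2 :* x) refl n′)))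
    n′<Q[t+1] : suc n′ < Q * (t + 1)
    n′<Q[t+1] = begin-strict
      suc n′               ≡⟨ m≡m%n+[m/n]*n (suc n′) Q ⟩
      suc n′ % Q + t * Q   <⟨ +-monoˡ-< (t * Q) (m%n<n (suc n′) Q) ⟩
      Q + t * Q            ≡⟨ solve 2 (λ x y → x :+ y :* x := x :* (y :+ con 1)) refl Q t ⟩
      Q * (t + 1)          ∎
    n′³≤ : n′ ^ 3 ≤ Q ^ 3 * (s + 3) ^ 3
    n′³≤ = ≤-trans (^-monoˡ-≤ 3 (≤-trans (n≤1+n n′) (<⇒≤ n′<Q[t+1])))
      (≤-reflexive (trans (cong (λ x → (Q * (x + 1)) ^ 3) t≡2+s)
        (solve 2 (λ x y → (x :* ((con 2 :+ y) :+ con 1)) :^ 3 := x :^ 3 :* (y :+ con 3) :^ 3) refl Q s)))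

disconnected-bound : ∀ {m n′ N K} → m ≡ n′ + N → 2 ≤ n′ → n′ ≤ N → m ≤ 2 * K →
  m * suc n′ * ((m ∸ n′) C K) + m * 2 ^ suc n′ * ((m ∸ 2 * (n′ ∸ 1)) C K) ≤ m * (suc n′ + 8) * (N C K)
disconnected-bound {K = zero}  refl (s≤s (s≤s _)) _ ()
disconnected-bound {m} {suc (suc d)} {N} {suc j} refl (s≤s (s≤s _)) 2+d≤N m≤2K = begin
  m * n * ((m ∸ (2 + d)) C suc j) + m * 2 ^ n * ((m ∸ 2 * (1 + d)) C suc j)
    ≡⟨ cong₂ (λ x y → m * n * (x C suc j) + m * 2 ^ n * (y C suc j)) (m+n∸m≡n (2 + d) N) m∸2[1+d]≡N∸d ⟩
  m * n * (N C suc j) + m * 2 ^ n * ((N ∸ d) C suc j)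
    ≡⟨ cong (λ p → m * n * (N C suc j) + m * p * ((N ∸ d) C suc j)) (^-distribˡ-+-* 2 3 d) ⟩
  m * n * (N C suc j) + m * (8 * 2 ^ d) * ((N ∸ d) C suc j)
    ≡⟨ cong (m * n * (N C suc j) +_) (solve 3 (λ x p c → x :* (con 8 :* p) :* c := x :* con 8 :* (p :* c)) refl m (2 ^ d) ((N ∸ d) C suc j)) ⟩
  m * n * (N C suc j) + m * 8 * (2 ^ d * ((N ∸ d) C suc j))
    ≤⟨ +-monoʳ-≤ (m * n * (N C suc j)) (*-monoʳ-≤ (m * 8) 2^d*[N∸d]C≤NC) ⟩
  m * n * (N C suc j) + m * 8 * (N C suc j)
    ≡⟨ solve 3 (λ x y c → x :* y :* c :+ x :* con 8 :* c := x :* (y :+ con 8) :* c) refl m n (N C suc j) ⟩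
  m * (n + 8) * (N C suc j) ∎
  where
  open ≤-Reasoning
  n = 3 + d
  d≤N = ≤-trans (m≤n+m d 2) 2+d≤N
  m∸2[1+d]≡N∸d : m ∸ 2 * (1 + d) ≡ N ∸ d
  m∸2[1+d]≡N∸d = trans (cong (m ∸_) (solve 1 (λ x → con 2 :* (con 1 :+ x) := (con 2 :+ x) :+ x) refl d)) ([m+n]∸[m+o]≡n∸o (2 + d) N d)
  2^d*[N∸d]C≤NC : 2 ^ d * ((N ∸ d) C suc j) ≤ N C suc j
  2^d*[N∸d]C≤NC = ≤-trans (2^t*nC[k+1]≤[n+t]C[k+1] (N ∸ d) j d (≤-trans (≤-reflexive (m∸n+n≡m d≤N)) (≤-trans (m≤n+m N (2 + d)) m≤2K)))
                          (≤-reflexive (cong (_C suc j) (m∸n+n≡m d≤N)))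

B*NCK<[N+t]C[1+K] : ∀ {B N K t} → K ≤ N → N + t ≤ 2 * suc K → 1 ≤ t → B < 2 ^ (t ∸ 1) → B * (N C K) < (N + t) C suc K
B*NCK<[N+t]C[1+K] {B} {N} {K} {suc t} K≤N N+t≤2+2K _ B<2^t = begin-strict
  B * (N C K)                   ≤⟨ *-monoʳ-≤ B (≤-trans (m≤m+n (N C K) (N C suc K)) (≤-reflexive (sym (pascal N K)))) ⟩
  B * (suc N C suc K)           <⟨ *-monoˡ-< (suc N C suc K) {{>-nonZero (0<nCk (s≤s K≤N))}} B<2^t ⟩
  2 ^ t * (suc N C suc K)       ≤⟨ 2^t*nC[k+1]≤[n+t]C[k+1] (suc N) K t (≤-trans (≤-reflexive (sym (+-suc N t))) N+t≤2+2K) ⟩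
  (suc N + t) C suc K           ≡⟨ cong (_C suc K) (+-suc N t) ⟨
  (N + suc t) C suc K           ∎
  where open ≤-Reasoning

-- Passing to ℚ

toℚᵘ-ℕ→ℚ : ∀ a → toℚᵘ (ℕ→ℚ a) ≡ mkℚᵘ (ℤ.+ a) 0
toℚᵘ-ℕ→ℚ a = cong toℚᵘ (ℚ.normalize-coprime (Coprime.sym (1-coprimeTo a)))

ℕ→ℚ-+ : ∀ a b → ℕ→ℚ (a + b) ≡ ℕ→ℚ a ℚ.+ ℕ→ℚ b
ℕ→ℚ-+ a b = ℚ.toℚᵘ-injective (ℚᵘ.≃-trans lhs (ℚᵘ.≃-sym (ℚᵘ.≃-trans (ℚ.toℚᵘ-homo-+ (ℕ→ℚ a) (ℕ→ℚ b))
  (subst₂ (λ u v → (u ℚᵘ.+ v) ℚᵘ.≃ mkℚᵘ (ℤ.+ a ℤ.* ℤ.+ 1 ℤ.+ ℤ.+ b ℤ.* ℤ.+ 1) 0)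
          (sym (toℚᵘ-ℕ→ℚ a)) (sym (toℚᵘ-ℕ→ℚ b)) ℚᵘ.≃-refl))))
  where
  lhs : toℚᵘ (ℕ→ℚ (a + b)) ℚᵘ.≃ mkℚᵘ (ℤ.+ a ℤ.* ℤ.+ 1 ℤ.+ ℤ.+ b ℤ.* ℤ.+ 1) 0
  lhs rewrite toℚᵘ-ℕ→ℚ (a + b) =
    *≡* (cong (ℤ._* ℤ.+ 1) (trans (ℤ.pos-+ a b) (sym (cong₂ ℤ._+_ (ℤ.*-identityʳ (ℤ.+ a)) (ℤ.*-identityʳ (ℤ.+ b))))))

ℕ→ℚ-* : ∀ a b → ℕ→ℚ (a * b) ≡ ℕ→ℚ a ℚ.* ℕ→ℚ b
ℕ→ℚ-* a b = ℚ.toℚᵘ-injective (ℚᵘ.≃-trans lhs (ℚᵘ.≃-sym (ℚᵘ.≃-trans (ℚ.toℚᵘ-homo-* (ℕ→ℚ a) (ℕ→ℚ b))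
  (subst₂ (λ u v → (u ℚᵘ.* v) ℚᵘ.≃ mkℚᵘ (ℤ.+ a ℤ.* ℤ.+ b) 0) (sym (toℚᵘ-ℕ→ℚ a)) (sym (toℚᵘ-ℕ→ℚ b)) ℚᵘ.≃-refl))))
  where
  lhs : toℚᵘ (ℕ→ℚ (a * b)) ℚᵘ.≃ mkℚᵘ (ℤ.+ a ℤ.* ℤ.+ b) 0
  lhs rewrite toℚᵘ-ℕ→ℚ (a * b) = *≡* (cong (ℤ._* ℤ.+ 1) (ℤ.pos-* a b))

ℕ→ℚ-mono-≤ : ∀ {a b} → a ≤ b → ℕ→ℚ a ℚ.≤ ℕ→ℚ b
ℕ→ℚ-mono-≤ {a} {b} a≤b = ℚ.toℚᵘ-cancel-≤ (subst₂ ℚᵘ._≤_ (sym (toℚᵘ-ℕ→ℚ a)) (sym (toℚᵘ-ℕ→ℚ b))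
  (*≤* (subst₂ ℤ._≤_ (sym (ℤ.*-identityʳ (ℤ.+ a))) (sym (ℤ.*-identityʳ (ℤ.+ b))) (+≤+ a≤b))))

ℕ→ℚ-cancel-< : ∀ {a b} → ℕ→ℚ a ℚ.< ℕ→ℚ b → a < b
ℕ→ℚ-cancel-< {a} {b} a<b with subst₂ ℚᵘ._<_ (toℚᵘ-ℕ→ℚ a) (toℚᵘ-ℕ→ℚ b) (ℚ.toℚᵘ-mono-< a<b)
... | *<* a<b′ = ℤ.drop‿+<+ (subst₂ ℤ._<_ (ℤ.*-identityʳ (ℤ.+ a)) (ℤ.*-identityʳ (ℤ.+ b)) a<b′)

ℕ→ℚ-∸ : ∀ {a b} → b ≤ a → ℕ→ℚ a ℚ.- ℕ→ℚ b ≡ ℕ→ℚ (a ∸ b)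
ℕ→ℚ-∸ {a} {b} b≤a = begin
  ℕ→ℚ a ℚ.- ℕ→ℚ b                    ≡⟨ cong (λ x → ℕ→ℚ x ℚ.- ℕ→ℚ b) (m∸n+n≡m b≤a) ⟨
  ℕ→ℚ (a ∸ b + b) ℚ.- ℕ→ℚ b          ≡⟨ cong (ℚ._- ℕ→ℚ b) (ℕ→ℚ-+ (a ∸ b) b) ⟩
  (ℕ→ℚ (a ∸ b) ℚ.+ ℕ→ℚ b) ℚ.- ℕ→ℚ b  ≡⟨ ℚ.+-assoc (ℕ→ℚ (a ∸ b)) (ℕ→ℚ b) (ℚ.- ℕ→ℚ b) ⟩
  ℕ→ℚ (a ∸ b) ℚ.+ (ℕ→ℚ b ℚ.- ℕ→ℚ b)  ≡⟨ cong (ℕ→ℚ (a ∸ b) ℚ.+_) (ℚ.+-inverseʳ (ℕ→ℚ b)) ⟩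
  ℕ→ℚ (a ∸ b) ℚ.+ 0ℚ                 ≡⟨ ℚ.+-identityʳ _ ⟩
  ℕ→ℚ (a ∸ b)                        ∎
  where open ≡-Reasoning

ℕ→ℚ-*-1/ : ∀ d .{{_ : NonZero d}} → ℕ→ℚ d ℚ.* (ℤ.+ 1 ℚ./ d) ≡ 1ℚ
ℕ→ℚ-*-1/ (suc d) = ℚ.toℚᵘ-injective (ℚᵘ.≃-trans (ℚ.toℚᵘ-homo-* (ℕ→ℚ (suc d)) (ℤ.+ 1 ℚ./ suc d))
  (subst₂ (λ u v → (u ℚᵘ.* v) ℚᵘ.≃ toℚᵘ 1ℚ) (sym (toℚᵘ-ℕ→ℚ (suc d))) (sym (cong toℚᵘ (ℚ.normalize-coprime (1-coprimeTo (suc d)))))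
    (*≡* (trans (ℤ.*-identityʳ _) (trans (ℤ.*-identityʳ _) (trans (cong ℤ.+_ (sym (*-identityˡ (suc d)))) (sym (ℤ.*-identityˡ _))))))))

falling-ℕ→ℚ : ∀ {a} k → k ≤ a → falling (ℕ→ℚ a) k ≡ ℕ→ℚ ((a C k) * k !)
falling-ℕ→ℚ {a} zero    _   = cong ℕ→ℚ (sym (trans (*-identityʳ _) (nC0≡1 a)))
falling-ℕ→ℚ {a} (suc k) k<a = begin
  falling (ℕ→ℚ a) k ℚ.* (ℕ→ℚ a ℚ.- ℕ→ℚ k)  ≡⟨ cong₂ ℚ._*_ (falling-ℕ→ℚ k (<⇒≤ k<a)) (ℕ→ℚ-∸ (<⇒≤ k<a)) ⟩
  ℕ→ℚ ((a C k) * k !) ℚ.* ℕ→ℚ (a ∸ k)      ≡⟨ ℕ→ℚ-* ((a C k) * k !) (a ∸ k) ⟨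
  ℕ→ℚ ((a C k) * k ! * (a ∸ k))             ≡⟨ cong ℕ→ℚ (begin
    (a C k) * k ! * (a ∸ k)          ≡⟨ solve 3 (λ c f d → c :* f :* d := d :* c :* f) refl (a C k) (k !) (a ∸ k) ⟩
    (a ∸ k) * (a C k) * k !          ≡⟨ cong (_* k !) ([k+1]*nC[k+1]≡[n∸k]*nCk a k) ⟨
    suc k * (a C suc k) * k !        ≡⟨ solve 3 (λ s c f → s :* c :* f := c :* (s :* f)) refl (suc k) (a C suc k) (k !) ⟩
    (a C suc k) * (suc k * k !)      ∎) ⟩
  ℕ→ℚ ((a C suc k) * suc k !)               ∎
  where open ≡-Reasoning

falling-monoˡ-≤ : ∀ {a} k {x} → k ≤ a → ℕ→ℚ a ℚ.≤ x → falling (ℕ→ℚ a) k ℚ.≤ falling x k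
falling-monoˡ-≤ zero    _   _   = ℚ.≤-refl
falling-monoˡ-≤ {a} (suc k) {x} k<a a≤x =
  ℚ.≤-trans (ℚ.*-monoʳ-≤-nonNeg (ℕ→ℚ a ℚ.- ℕ→ℚ k) ih) (ℚ.*-monoˡ-≤-nonNeg (falling x k) (ℚ.+-monoˡ-≤ (ℚ.- ℕ→ℚ k) a≤x))
  where
  ih = falling-monoˡ-≤ k (<⇒≤ k<a) a≤x
  0≤falling : 0ℚ ℚ.≤ falling (ℕ→ℚ a) k
  0≤falling = subst (0ℚ ℚ.≤_) (sym (falling-ℕ→ℚ k (<⇒≤ k<a))) (ℕ→ℚ-mono-≤ {0} {(a C k) * k !} z≤n)
  instance
    _ : NonNegative (falling x k)
    _ = ℚ.nonNegative (ℚ.≤-trans 0≤falling ih)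
    _ : NonNegative (ℕ→ℚ a ℚ.- ℕ→ℚ k)
    _ = ℚ.nonNegative (subst (0ℚ ℚ.≤_) (sym (ℕ→ℚ-∸ (<⇒≤ k<a))) (ℕ→ℚ-mono-≤ {0} {a ∸ k} z≤n))

aCk≤binomℚ : ∀ {a} k {x} → k ≤ a → ℕ→ℚ a ℚ.≤ x → ℕ→ℚ (a C k) ℚ.≤ binomℚ x k
aCk≤binomℚ {a} k {x} k≤a a≤x = begin
  ℕ→ℚ (a C k)                                      ≡⟨ ℚ.*-identityʳ _ ⟨
  ℕ→ℚ (a C k) ℚ.* 1ℚ                               ≡⟨ cong (ℕ→ℚ (a C k) ℚ.*_) (ℕ→ℚ-*-1/ (k !) {{k !≢0}}) ⟨
  ℕ→ℚ (a C k) ℚ.* (ℕ→ℚ (k !) ℚ.* 1/k!)              ≡⟨ ℚ.*-assoc (ℕ→ℚ (a C k)) _ _ ⟨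
  ℕ→ℚ (a C k) ℚ.* ℕ→ℚ (k !) ℚ.* 1/k!                ≡⟨ cong (ℚ._* 1/k!) (trans (falling-ℕ→ℚ k k≤a) (ℕ→ℚ-* (a C k) (k !))) ⟨
  falling (ℕ→ℚ a) k ℚ.* 1/k!                       ≤⟨ ℚ.*-monoʳ-≤-nonNeg 1/k! (falling-monoˡ-≤ k k≤a a≤x) ⟩
  falling x k ℚ.* 1/k!                             ≡⟨ cong (λ b → if b then falling x k ℚ.* 1/k! else 0ℚ)
                                                          (dec-true (ℕ→ℚ k ℚ.≤? x) (ℚ.≤-trans (ℕ→ℚ-mono-≤ k≤a) a≤x)) ⟨
  binomℚ x k                                       ∎
  where
  open ℚ.≤-Reasoning
  1/k! = (ℤ.+ 1 ℚ./ k !) {{k !≢0}}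
  instance _ = ℚ.normalize-nonNeg 1 (k !) {{k !≢0}}

t≤ε*n : ∀ {p q-1} .(c : Coprime (suc p) (suc q-1)) {t n} → t * suc q-1 ≤ n → ℕ→ℚ t ℚ.≤ mkℚ +[1+ p ] q-1 c ℚ.* ℕ→ℚ n
t≤ε*n {p} {q-1} c {t} {n} tq≤n = begin
  ℕ→ℚ t                       ≤⟨ ℕ→ℚ-mono-≤ (m≤n*m t (suc p)) ⟩
  ℕ→ℚ (suc p * t)             ≡⟨ ℕ→ℚ-* (suc p) t ⟩
  ℕ→ℚ (suc p) ℚ.* ℕ→ℚ t       ≡⟨ cong (ℚ._* ℕ→ℚ t) ε*q≡p ⟨
  ε ℚ.* ℕ→ℚ q ℚ.* ℕ→ℚ t       ≡⟨ trans (ℚ.*-assoc ε (ℕ→ℚ q) (ℕ→ℚ t)) (cong (ε ℚ.*_) (sym (ℕ→ℚ-* q t))) ⟩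
  ε ℚ.* ℕ→ℚ (q * t)           ≤⟨ ℚ.*-monoˡ-≤-nonNeg ε (ℕ→ℚ-mono-≤ (≤-trans (≤-reflexive (*-comm q t)) tq≤n)) ⟩
  ε ℚ.* ℕ→ℚ n                 ∎
  where
  open ℚ.≤-Reasoning
  q = suc q-1
  ε = mkℚ +[1+ p ] q-1 c
  instance _ = ℚ.pos⇒nonNeg ε
  ε*q≡p : ε ℚ.* ℕ→ℚ q ≡ ℕ→ℚ (suc p)
  ε*q≡p = ℚ.toℚᵘ-injective (ℚᵘ.≃-trans (ℚ.toℚᵘ-homo-* ε (ℕ→ℚ q))
    (subst₂ (λ u v → (mkℚᵘ +[1+ p ] q-1 ℚᵘ.* u) ℚᵘ.≃ v) (sym (toℚᵘ-ℕ→ℚ q)) (sym (toℚᵘ-ℕ→ℚ (suc p)))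
      (*≡* (trans (ℤ.*-identityʳ _) (cong (+[1+ p ] ℤ.*_) (cong ℤ.+_ (sym (*-identityʳ q))))))))

aCk<l : ∀ {a k l x} → k ≤ a → ℕ→ℚ a ℚ.≤ x → binomℚ x k ℚ.< ℕ→ℚ l ⊎ (l ≡ 0 × x ℚ.< ℕ→ℚ k) → a C k < l
aCk<l {k = k} k≤a a≤x (inj₁ binom<l)  = ℕ→ℚ-cancel-< (ℚ.≤-<-trans (aCk≤binomℚ k k≤a a≤x) binom<l)
aCk<l         k≤a a≤x (inj₂ (_ , x<k)) = ⊥-elim (ℚ.<-irrefl refl (ℚ.<-≤-trans x<k (ℚ.≤-trans (ℕ→ℚ-mono-≤ k≤a) a≤x)))

-- For ε = p / q the proof takes t = ⌊n / Q⌋ with Q = 2q, so that t ≤ εn and t < n; beyond the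
-- threshold t ≥ 64Q + 2, where 2^(t−1) exceeds C(n,2) (n + 8).
threshold : ℕ → ℕ
threshold Q = Q * (64 * Q + 2) + 9

shadow-expands : ∀ {p q-1} .(c : Coprime (suc p) (suc q-1)) (n : ℕ) → threshold (2 * suc q-1) < n →
  (k : ℕ) → ⌈ (n C 2) /2⌉ + 1 ≤ k → k < ⌈ (n C 2) /2⌉ + n →
  (Xs : List (Adj n)) → Unique Xs → All (InG n k) Xs →
  (binomℚ (ℕ→ℚ ((n ∸ 1) C 2) ℚ.+ mkℚ +[1+ p ] q-1 c ℚ.* ℕ→ℚ n) k ℚ.< ℕ→ℚ (length Xs)
    ⊎ (length Xs ≡ 0 × ℕ→ℚ ((n ∸ 1) C 2) ℚ.+ mkℚ +[1+ p ] q-1 c ℚ.* ℕ→ℚ n ℚ.< ℕ→ℚ k)) →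
  (S : List (Adj n)) → Enumerates S (Shadow n k Xs) →
  length Xs < length S
shadow-expands c (suc n′) _ zero k-low = ⊥-elim (n≮0 (≤-trans (m≤n+m 1 _) k-low))
shadow-expands {p} {q-1} c (suc n′) (s≤s threshold≤n′) (suc K) k-low k-high Xs Xs! Xs⊆𝒢 x₀-bound S S-enum =
  x*[1+K]≤s*K+B⇒B<x⇒x<s
    (≤-trans count (≤-trans (+-monoˡ-≤ _ (+-monoˡ-≤ _ (*-monoʳ-≤ (length S) m∸K≤K))) (≤-reflexive (+-assoc (length S * K) _ _))))
    (≤-<-trans (disconnected-bound {K = K} refl 2≤n′ n′≤N m≤2K)
      (<-trans (B*NCK<[N+t]C[1+K] K≤N N+t≤2+2K 1≤t ([n′+n′C2]*[n+8]<2^[t∸1] Q threshold≤n′))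
               (aCk<l {N + t} {suc K} k≤N+t N+t≤x₀ x₀-bound)))
  where
  Q = 2 * suc q-1
  N = n′ C 2
  m = n′ + N
  t = suc n′ / Q
  count : length Xs * suc K ≤ length S * (m ∸ K) + m * suc n′ * ((m ∸ n′) C K) + m * 2 ^ suc n′ * ((m ∸ 2 * (n′ ∸ 1)) C K)
  count = subst (λ x → length Xs * suc K ≤ length S * (x ∸ K) + x * suc n′ * ((x ∸ n′) C K) + x * 2 ^ suc n′ * ((x ∸ 2 * (n′ ∸ 1)) C K))
                ([1+n]C2≡n+nC2 n′) (shadow-double-count Xs Xs! Xs⊆𝒢 S S-enum)
  9≤n′ = ≤-trans (m≤n+m 9 (Q * (64 * Q + 2))) threshold≤n′
  3n′≤N = 3n≤nC2 9≤n′
  2≤n′ = ≤-trans (s≤s (s≤s z≤n)) 9≤n′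
  n′≤N = ≤-trans (m≤m+n n′ (2 * n′)) 3n′≤N
  bounds = middle-layer-bounds 3n′≤N (subst (λ x → ⌈ x /2⌉ + 1 ≤ suc K) ([1+n]C2≡n+nC2 n′) k-low)
                               (subst (λ x → suc K < ⌈ x /2⌉ + suc n′) ([1+n]C2≡n+nC2 n′) k-high)
  m≤2K = proj₁ bounds
  k≤N = proj₂ bounds
  K≤N = ≤-trans (n≤1+n K) k≤N
  m∸K≤K : m ∸ K ≤ K
  m∸K≤K = ≤-trans (∸-monoˡ-≤ K m≤2K) (≤-reflexive (trans (cong (_∸ K) (solve 1 (λ x → con 2 :* x := x :+ x) refl K)) (m+n∸n≡m K K)))
  1≤t = ≤-trans (s≤s z≤n) (64Q+2≤[1+n′]/Q Q (≤-trans (m≤m+n (Q * (64 * Q + 2)) 9) threshold≤n′))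
  t≤n′ = [1+n′]/Q≤n′ Q (*-monoʳ-≤ 2 (s≤s (z≤n {q-1}))) 1≤t
  N+t≤2+2K = ≤-trans (+-monoʳ-≤ N t≤n′) (≤-trans (≤-reflexive (+-comm N n′)) (≤-trans m≤2K (*-monoʳ-≤ 2 (n≤1+n K))))
  k≤N+t = ≤-trans k≤N (m≤m+n N t)
  N+t≤x₀ = ℚ.≤-trans (ℚ.≤-reflexive (ℕ→ℚ-+ N t))
                     (ℚ.+-monoʳ-≤ (ℕ→ℚ N) (t≤ε*n c {t} {suc n′} (≤-trans (*-monoʳ-≤ t (m≤m+n (suc q-1) _)) (m/n*n≤m (suc n′) Q))))

lemma3p5 : (ε : ℚ) → Positive ε →
    ∃[ n₂ ] ((n : ℕ) → n₂ < n →
      (k : ℕ) → ⌈ (n C 2) /2⌉ + 1 ≤ k → k < ⌈ (n C 2) /2⌉ + n →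
      (Xs : List (Adj n)) → Unique Xs → All (InG n k) Xs →
      (binomℚ (ℕ→ℚ ((n Data.Nat.∸ 1) C 2) ℚ.+ ε ℚ.* ℕ→ℚ n) k ℚ.< ℕ→ℚ (length Xs)
        ⊎ (length Xs ≡ 0 × ℕ→ℚ ((n Data.Nat.∸ 1) C 2) ℚ.+ ε ℚ.* ℕ→ℚ n ℚ.< ℕ→ℚ k)) →
      (S : List (Adj n)) → Enumerates S (Shadow n k Xs) →
      length Xs < length S)
lemma3p5 (mkℚ +[1+ p ] q-1 c) _ = threshold (2 * suc q-1) , shadow-expands c
lemma3p5 (mkℚ (ℤ.+ 0)  _ _) ()
lemma3p5 (mkℚ -[1+ _ ] _ _) ()
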